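{- In $\mathrm{E\text{ - }HA}^{\omega*}_{\mathrm{st}}$, the idealization principle $\mathrm{I}$ implies, for every type $\sigma$, the existence of nonstandard elements $\exists x^\sigma\,\neg\mathrm{st}(x)$, as well as $\mathrm{LLPO}$ for every type $\sigma$: for all internal $\varphi,\psi$ (possibly with parameters), $\forall^{\mathrm{st}}x^\sigma,y^\sigma(\varphi(x)\lor\psi(y))\to\forall^{\mathrm{st}}x^\sigma\varphi(x)\lor\forall^{\mathrm{st}}y^\sigma\psi(y)$.
   Context: Finite types: $0$, $\sigma\to\tau$, $\sigma^*$ (finite sequences). $\mathcal T^*$: Gödel's T extended with $\varepsilon_\sigma$, prepending $c$, list recursors. $\mathrm{E\text{ - }HA}^{\omega*}$: intuitionistic extensional arithmetic in these types over $\mathcal T^*$ with full induction and $\forall y^{\sigma^*}(y=\varepsilon\lor\exists a,x\,y=c(a,x))$. $s\in t:\equiv\exists i<|t|(s=(t)_i)$. $\mathrm{E\text{ - }HA}^{\omega*}_{\mathrm{st}}$: add predicates $\mathrm{st}^\sigma$, quantifiers $\forall^{\mathrm{st}},\exists^{\mathrm{st}}$ (formulas without them are internal), axioms $\forall^{\mathrm{st}}x\Phi\leftrightarrow\forall x(\mathrm{st}(x)\to\Phi)$, $\exists^{\mathrm{st}}x\Phi\leftrightarrow\exists x(\mathrm{st}(x)\land\Phi)$, $\mathrm{st}(x)\land x=y\to\mathrm{st}(y)$, $\mathrm{st}(t)$ for closed $t\in\mathcal T^*$, $\mathrm{st}(f)\land\mathrm{st}(x)\to\mathrm{st}(fx)$,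 external induction for all formulas; internal induction only for internal formulas; intuitionistic logic. $\mathrm{I}$ (idealization): $\forall^{\mathrm{st}}x^{\sigma^*}\exists y^\tau\forall x'\in x\,\varphi(x',y)\to\exists y^\tau\forall^{\mathrm{st}}x^\sigma\varphi(x,y)$ for internal $\varphi$ (parameters allowed), all types. -}

module Defs where

open import Data.List using (List; []; _∷_; map)
open import Data.List.Membership.Propositional using (_∈_)
open import Data.Sum using (_⊎_)

infixr 7 _⇒_
data Ty : Set where
  𝟘   : Ty
  _⇒_ : Ty → Ty → Ty
  _*  : Ty → Ty

Ctx : Set
Ctx = List Ty

data _∋_ : Ctx → Ty → Set where
  here  : ∀ {Γ σ} → (σ ∷ Γ) ∋ σ
  there : ∀ {Γ σ τ} → Γ ∋ σ → (τ ∷ Γ) ∋ σ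

-- Terms of T*  (constants: 0, S, K, S-combinator, recursor R,
-- empty sequence ε, prepending c, list recursor L)

data Const : Ty → Set where
  cZ  : Const 𝟘
  cS  : Const (𝟘 ⇒ 𝟘)
  cK  : ∀ {σ τ} → Const (σ ⇒ τ ⇒ σ)
  cΣ  : ∀ {ρ σ τ} → Const ((ρ ⇒ σ ⇒ τ) ⇒ (ρ ⇒ σ) ⇒ ρ ⇒ τ)
  cR  : ∀ {σ} → Const (σ ⇒ (𝟘 ⇒ σ ⇒ σ) ⇒ 𝟘 ⇒ σ)
  cε  : ∀ {σ} → Const (σ *)
  cc  : ∀ {σ} → Const (σ ⇒ σ * ⇒ σ *)
  cL  : ∀ {σ ρ} → Const (ρ ⇒ (σ ⇒ σ * ⇒ ρ ⇒ ρ) ⇒ σ * ⇒ ρ)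

infixl 9 _·_
data Tm (Γ : Ctx) : Ty → Set where
  var : ∀ {σ} → Γ ∋ σ → Tm Γ σ
  con : ∀ {σ} → Const σ → Tm Γ σ
  _·_ : ∀ {σ τ} → Tm Γ (σ ⇒ τ) → Tm Γ σ → Tm Γ τ

Ren : Ctx → Ctx → Set
Ren Γ Δ = ∀ {σ} → Γ ∋ σ → Δ ∋ σ

liftR : ∀ {Γ Δ τ} → Ren Γ Δ → Ren (τ ∷ Γ) (τ ∷ Δ)
liftR r here      = here
liftR r (there x) = there (r x)

renT : ∀ {Γ Δ σ} → Ren Γ Δ → Tm Γ σ → Tm Δ σ
renT r (var x)  = var (r x)
renT r (con c)  = con c
renT r (f · a)  = renT r f · renT r a

Sub : Ctx → Ctx → Set
Sub Γ Δ = ∀ {σ} → Γ ∋ σ → Tm Δ σ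

liftS : ∀ {Γ Δ τ} → Sub Γ Δ → Sub (τ ∷ Γ) (τ ∷ Δ)
liftS s here      = var here
liftS s (there x) = renT there (s x)

subT : ∀ {Γ Δ σ} → Sub Γ Δ → Tm Γ σ → Tm Δ σ
subT s (var x) = s x
subT s (con c) = con c
subT s (f · a) = subT s f · subT s a

wkT : ∀ {Γ σ τ} → Tm Γ σ → Tm (τ ∷ Γ) σ
wkT = renT there

closedT : ∀ {Γ σ} → Tm [] σ → Tm Γ σ
closedT = renT (λ ())

abs : ∀ {Γ σ τ} → Tm (σ ∷ Γ) τ → Tm Γ (σ ⇒ τ)
abs {σ = σ} (var here) = con (cΣ {σ} {σ ⇒ σ} {σ}) · con cK · con cK
abs (var (there x))    = con cK · var x
abs (con c)            = con cK · con c
abs (f · a)            = con cΣ · abs f · abs a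

Z : ∀ {Γ} → Tm Γ 𝟘
Z = con cZ

Sc : ∀ {Γ} → Tm Γ (𝟘 ⇒ 𝟘)
Sc = con cS

-- the canonical "zero" 0_σ of each type (default value of projections)
zeroT : ∀ {Γ} (σ : Ty) → Tm Γ σ
zeroT 𝟘       = Z
zeroT (σ ⇒ τ) = con cK · zeroT τ
zeroT (σ *)   = con cε

plus : ∀ {Γ} → Tm Γ (𝟘 ⇒ 𝟘 ⇒ 𝟘)
plus = abs (abs (con cR · var (there here) · (con cK · Sc) · var here))

len : ∀ {Γ σ} → Tm Γ (σ * ⇒ 𝟘)
len = con cL · Z · (con cK · (con cK · Sc))

-- projection (t)_i  (= 0_σ for i ≥ |t|):
--   (ε)_i = 0_σ ,  (c(a,y))_0 = a ,  (c(a,y))_{n+1} = (y)_n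
proj : ∀ {Γ σ} → Tm Γ (σ * ⇒ 𝟘 ⇒ σ)
proj {σ = σ} = con cL · (con cK · zeroT σ) · step
  where
  step : ∀ {Γ} → Tm Γ (σ ⇒ σ * ⇒ (𝟘 ⇒ σ) ⇒ 𝟘 ⇒ σ)
  step = abs (abs (abs (abs
           (con cR · var (there (there (there here)))
                   · abs (abs (var (there (there (there here))) · var (there here)))
                   · var here))))

infixr 4 _⊃_
infixr 5 _∨'_
infixr 6 _∧'_
infix  7 _≐_

data Fm (Γ : Ctx) : Set where
  _≐_  : Tm Γ 𝟘 → Tm Γ 𝟘 → Fm Γ
  ⊥'   : Fm Γ
  _∧'_ : Fm Γ → Fm Γ → Fm Γ
  _∨'_ : Fm Γ → Fm Γ → Fm Γ
  _⊃_  : Fm Γ → Fm Γ → Fm Γ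
  ∀'   : (σ : Ty) → Fm (σ ∷ Γ) → Fm Γ
  ∃'   : (σ : Ty) → Fm (σ ∷ Γ) → Fm Γ
  st   : ∀ {σ} → Tm Γ σ → Fm Γ
  ∀st  : (σ : Ty) → Fm (σ ∷ Γ) → Fm Γ
  ∃st  : (σ : Ty) → Fm (σ ∷ Γ) → Fm Γ

¬' : ∀ {Γ} → Fm Γ → Fm Γ
¬' φ = φ ⊃ ⊥'

data Internal {Γ : Ctx} : Fm Γ → Set where
  i≐ : ∀ {s t} → Internal (s ≐ t)
  i⊥ : Internal ⊥'
  i∧ : ∀ {φ ψ} → Internal φ → Internal ψ → Internal (φ ∧' ψ)
  i∨ : ∀ {φ ψ} → Internal φ → Internal ψ → Internal (φ ∨' ψ)
  i⊃ : ∀ {φ ψ} → Internal φ → Internal ψ → Internal (φ ⊃ ψ)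
  i∀ : ∀ {σ φ} → Internal {σ ∷ Γ} φ → Internal (∀' σ φ)
  i∃ : ∀ {σ φ} → Internal {σ ∷ Γ} φ → Internal (∃' σ φ)

renF : ∀ {Γ Δ} → Ren Γ Δ → Fm Γ → Fm Δ
renF r (s ≐ t)   = renT r s ≐ renT r t
renF r ⊥'        = ⊥'
renF r (φ ∧' ψ)  = renF r φ ∧' renF r ψ
renF r (φ ∨' ψ)  = renF r φ ∨' renF r ψ
renF r (φ ⊃ ψ)   = renF r φ ⊃ renF r ψ
renF r (∀' σ φ)  = ∀' σ (renF (liftR r) φ)
renF r (∃' σ φ)  = ∃' σ (renF (liftR r) φ)
renF r (st t)    = st (renT r t)
renF r (∀st σ φ) = ∀st σ (renF (liftR r) φ)
renF r (∃st σ φ) = ∃st σ (renF (liftR r) φ)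

subF : ∀ {Γ Δ} → Sub Γ Δ → Fm Γ → Fm Δ
subF s (a ≐ b)   = subT s a ≐ subT s b
subF s ⊥'        = ⊥'
subF s (φ ∧' ψ)  = subF s φ ∧' subF s ψ
subF s (φ ∨' ψ)  = subF s φ ∨' subF s ψ
subF s (φ ⊃ ψ)   = subF s φ ⊃ subF s ψ
subF s (∀' σ φ)  = ∀' σ (subF (liftS s) φ)
subF s (∃' σ φ)  = ∃' σ (subF (liftS s) φ)
subF s (st t)    = st (subT s t)
subF s (∀st σ φ) = ∀st σ (subF (liftS s) φ)
subF s (∃st σ φ) = ∃st σ (subF (liftS s) φ)

wkF : ∀ {Γ τ} → Fm Γ → Fm (τ ∷ Γ)
wkF = renF there

sub0 : ∀ {Γ σ} → Tm Γ σ → Sub (σ ∷ Γ) Γ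
sub0 t here      = t
sub0 t (there x) = var x

_[_] : ∀ {Γ σ} → Fm (σ ∷ Γ) → Tm Γ σ → Fm Γ
φ [ t ] = subF (sub0 t) φ

subSuc : ∀ {Γ} → Sub (𝟘 ∷ Γ) (𝟘 ∷ Γ)
subSuc here      = Sc · var here
subSuc (there x) = var (there x)

lt : ∀ {Γ} → Tm Γ 𝟘 → Tm Γ 𝟘 → Fm Γ
lt i n = ∃' 𝟘 (plus · wkT i · (Sc · var here) ≐ wkT n)

Eq : ∀ {Γ} (σ : Ty) → Tm Γ σ → Tm Γ σ → Fm Γ
Eq 𝟘       s t = s ≐ t
Eq (σ ⇒ τ) s t = ∀' σ (Eq τ (wkT s · var here) (wkT t · var here))
Eq (σ *)   s t = (len · s ≐ len · t)
                 ∧' ∀' 𝟘 (lt (var here) (len · wkT s)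
                           ⊃ Eq σ (proj · wkT s · var here) (proj · wkT t · var here))

mem : ∀ {Γ σ} → Tm Γ σ → Tm Γ (σ *) → Fm Γ
mem {σ = σ} s t = ∃' 𝟘 (lt (var here) (len · wkT t) ∧' Eq σ (wkT s) (proj · wkT t · var here))

Axioms : Set₁
Axioms = (Γ : Ctx) → Fm Γ → Set

data Pf (Ax : Axioms) : (Γ : Ctx) → List (Fm Γ) → Fm Γ → Set where
  ax   : ∀ {Γ Δ φ} → Ax Γ φ → Pf Ax Γ Δ φ
  hyp  : ∀ {Γ Δ φ} → φ ∈ Δ → Pf Ax Γ Δ φ
  ⊥E   : ∀ {Γ Δ φ} → Pf Ax Γ Δ ⊥' → Pf Ax Γ Δ φ
  ∧I   : ∀ {Γ Δ φ ψ} → Pf Ax Γ Δ φ → Pf Ax Γ Δ ψ → Pf Ax Γ Δ (φ ∧' ψ)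
  ∧E₁  : ∀ {Γ Δ φ ψ} → Pf Ax Γ Δ (φ ∧' ψ) → Pf Ax Γ Δ φ
  ∧E₂  : ∀ {Γ Δ φ ψ} → Pf Ax Γ Δ (φ ∧' ψ) → Pf Ax Γ Δ ψ
  ∨I₁  : ∀ {Γ Δ φ ψ} → Pf Ax Γ Δ φ → Pf Ax Γ Δ (φ ∨' ψ)
  ∨I₂  : ∀ {Γ Δ φ ψ} → Pf Ax Γ Δ ψ → Pf Ax Γ Δ (φ ∨' ψ)
  ∨E   : ∀ {Γ Δ φ ψ χ} → Pf Ax Γ Δ (φ ∨' ψ) → Pf Ax Γ (φ ∷ Δ) χ → Pf Ax Γ (ψ ∷ Δ) χ
         → Pf Ax Γ Δ χ
  ⊃I   : ∀ {Γ Δ φ ψ} → Pf Ax Γ (φ ∷ Δ) ψ → Pf Ax Γ Δ (φ ⊃ ψ)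
  ⊃E   : ∀ {Γ Δ φ ψ} → Pf Ax Γ Δ (φ ⊃ ψ) → Pf Ax Γ Δ φ → Pf Ax Γ Δ ψ
  ∀I   : ∀ {Γ Δ σ φ} → Pf Ax (σ ∷ Γ) (map wkF Δ) φ → Pf Ax Γ Δ (∀' σ φ)
  ∀E   : ∀ {Γ Δ σ φ} → Pf Ax Γ Δ (∀' σ φ) → (t : Tm Γ σ) → Pf Ax Γ Δ (φ [ t ])
  ∃I   : ∀ {Γ Δ σ φ} → (t : Tm Γ σ) → Pf Ax Γ Δ (φ [ t ]) → Pf Ax Γ Δ (∃' σ φ)
  ∃E   : ∀ {Γ Δ σ φ ψ} → Pf Ax Γ Δ (∃' σ φ) → Pf Ax (σ ∷ Γ) (φ ∷ map wkF Δ) (wkF ψ)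
         → Pf Ax Γ Δ ψ

-- Non-logical axioms of E-HA^{ω*}_st (given as schemata; free variables
-- of the context Γ act as parameters)

data BaseAx : Axioms where
  eqRefl  : ∀ {Γ} (t : Tm Γ 𝟘) → BaseAx Γ (t ≐ t)
  eqSubst : ∀ {Γ} (φ : Fm (𝟘 ∷ Γ)) → Internal φ → (s t : Tm Γ 𝟘)
            → BaseAx Γ (s ≐ t ⊃ φ [ s ] ⊃ φ [ t ])
  ext     : ∀ {Γ σ τ} (u : Tm Γ (σ ⇒ τ)) (s t : Tm Γ σ)
            → BaseAx Γ (Eq σ s t ⊃ Eq τ (u · s) (u · t))
  sucNZ   : ∀ {Γ} (t : Tm Γ 𝟘) → BaseAx Γ (¬' (Sc · t ≐ Z))
  sucInj  : ∀ {Γ} (s t : Tm Γ 𝟘) → BaseAx Γ (Sc · s ≐ Sc · t ⊃ s ≐ t)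
  axK     : ∀ {Γ σ τ} (s : Tm Γ σ) (t : Tm Γ τ) → BaseAx Γ (Eq σ (con cK · s · t) s)
  axΣ     : ∀ {Γ ρ σ τ} (x : Tm Γ (ρ ⇒ σ ⇒ τ)) (y : Tm Γ (ρ ⇒ σ)) (z : Tm Γ ρ)
            → BaseAx Γ (Eq τ (con cΣ · x · y · z) (x · z · (y · z)))
  axR0    : ∀ {Γ σ} (a : Tm Γ σ) (f : Tm Γ (𝟘 ⇒ σ ⇒ σ))
            → BaseAx Γ (Eq σ (con cR · a · f · Z) a)
  axRS    : ∀ {Γ σ} (a : Tm Γ σ) (f : Tm Γ (𝟘 ⇒ σ ⇒ σ)) (n : Tm Γ 𝟘)
            → BaseAx Γ (Eq σ (con cR · a · f · (Sc · n)) (f · n · (con cR · a · f · n)))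
  axL0    : ∀ {Γ σ ρ} (a : Tm Γ ρ) (f : Tm Γ (σ ⇒ σ * ⇒ ρ ⇒ ρ))
            → BaseAx Γ (Eq ρ (con cL · a · f · con cε) a)
  axLc    : ∀ {Γ σ ρ} (a : Tm Γ ρ) (f : Tm Γ (σ ⇒ σ * ⇒ ρ ⇒ ρ)) (x : Tm Γ σ) (l : Tm Γ (σ *))
            → BaseAx Γ (Eq ρ (con cL · a · f · (con cc · x · l))
                             (f · x · l · (con cL · a · f · l)))
  axList  : ∀ {Γ σ}
            → BaseAx Γ (∀' (σ *) (Eq (σ *) (var here) (con cε)
                 ∨' ∃' σ (∃' (σ *) (Eq (σ *) (var (there (there here)))
                                              (con cc · var (there here) · var here)))))
  indInt  : ∀ {Γ} (φ : Fm (𝟘 ∷ Γ)) → Internal φ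
            → BaseAx Γ (φ [ Z ] ⊃ ∀' 𝟘 (φ ⊃ subF subSuc φ) ⊃ ∀' 𝟘 φ)
  ∀st→    : ∀ {Γ σ} (φ : Fm (σ ∷ Γ)) → BaseAx Γ (∀st σ φ ⊃ ∀' σ (st (var here) ⊃ φ))
  ∀st←    : ∀ {Γ σ} (φ : Fm (σ ∷ Γ)) → BaseAx Γ (∀' σ (st (var here) ⊃ φ) ⊃ ∀st σ φ)
  ∃st→    : ∀ {Γ σ} (φ : Fm (σ ∷ Γ)) → BaseAx Γ (∃st σ φ ⊃ ∃' σ (st (var here) ∧' φ))
  ∃st←    : ∀ {Γ σ} (φ : Fm (σ ∷ Γ)) → BaseAx Γ (∃' σ (st (var here) ∧' φ) ⊃ ∃st σ φ)
  stEq    : ∀ {Γ σ} (x y : Tm Γ σ) → BaseAx Γ (st x ∧' Eq σ x y ⊃ st y)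
  stClos  : ∀ {Γ σ} (t : Tm [] σ) → BaseAx Γ (st (closedT t))
  stApp   : ∀ {Γ σ τ} (f : Tm Γ (σ ⇒ τ)) (x : Tm Γ σ) → BaseAx Γ (st f ∧' st x ⊃ st (f · x))
  indExt  : ∀ {Γ} (φ : Fm (𝟘 ∷ Γ))
            → BaseAx Γ (φ [ Z ] ⊃ ∀st 𝟘 (φ ⊃ subF subSuc φ) ⊃ ∀st 𝟘 φ)

-- Idealization I:
--   ∀st x^{σ*} ∃y^τ ∀x' ∈ x φ(x',y) → ∃y^τ ∀st x^σ φ(x,y)
-- φ : Fm (σ ∷ τ ∷ Γ): variable 0 is x (type σ), variable 1 is y (type τ),
-- Γ are parameters.

IFormula : ∀ {Γ} (σ τ : Ty) → Fm (σ ∷ τ ∷ Γ) → Fm Γ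
IFormula σ τ φ =
  ∀st (σ *) (∃' τ (∀' σ (mem (var here) (var (there (there here)))
                          ⊃ renF (liftR (liftR there)) φ)))
  ⊃ ∃' τ (∀st σ φ)

data IAx : Axioms where
  ideal : ∀ {Γ} (σ τ : Ty) (φ : Fm (σ ∷ τ ∷ Γ)) → Internal φ → IAx Γ (IFormula σ τ φ)

EHAstI : Axioms
EHAstI Γ φ = BaseAx Γ φ ⊎ IAx Γ φ

NonStd : (σ : Ty) → Fm []
NonStd σ = ∃' σ (¬' (st (var here)))

renX : ∀ {Γ σ} → Ren (σ ∷ Γ) (σ ∷ σ ∷ Γ)
renX here      = there here
renX (there v) = there (there v)

LLPO : ∀ {Γ} (σ : Ty) → Fm (σ ∷ Γ) → Fm (σ ∷ Γ) → Fm Γ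
LLPO σ φ ψ =
  ∀st σ (∀st σ (renF renX φ ∨' renF (liftR there) ψ))
  ⊃ (∀st σ φ ∨' ∀st σ ψ)

module Submission where

open import Data.List using (List; []; _∷_; map)
open import Data.List.Membership.Propositional using (_∈_)
open import Data.List.Relation.Unary.Any using (here; there)
open import Data.Maybe using (Maybe; just; nothing)
open import Data.Nat using (ℕ; zero; suc)
open import Data.Product using (Σ; _×_; _,_; proj₁; proj₂)
open import Data.Sum using (_⊎_; inj₁; inj₂)
open import Relation.Binary.PropositionalEquality using (_≡_; refl; sym; trans; cong; cong₂; subst)

open import Defs

-- Nonstandard elements: idealization applied to x < y on ℕ. Every standard finite sequence
-- is bounded by the sum of the successors of its entries, so some y exceeds every standard
-- x, and y itself cannot be standard. A nonstandard n : ℕ yields one of every type σ, since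
-- n is recovered from its canonical image in σ by a standard closed term.
--
-- LLPO: idealization applied to Θ(x, y) := (y = 0 → φ x) ∧ (y = 0 ∨ ψ x). Given the
-- hypothesis ∀st x, y (φ x ∨ ψ y), two external inductions along a standard finite
-- sequence L show that φ holds on all of L or ψ does, so y = 0 resp. y = 1 satisfies Θ on
-- L. The y obtained from I then decides: y = 0 gives ∀st x φ x, and y ≠ 0 gives ∀st x ψ x.

infix 4 _≗S_

_≗S_ : ∀ {Γ Δ} → Sub Γ Δ → Sub Γ Δ → Set
s ≗S s' = ∀ {σ} (x : _ ∋ σ) → s x ≡ s' x

ren→sub : ∀ {Γ Δ} → Ren Γ Δ → Sub Γ Δ
ren→sub r x = var (r x)

liftS-cong : ∀ {Γ Δ τ} {s s' : Sub Γ Δ} → s ≗S s' → liftS {τ = τ} s ≗S liftS s'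
liftS-cong e here      = refl
liftS-cong e (there x) = cong wkT (e x)

subT-cong : ∀ {Γ Δ σ} {s s' : Sub Γ Δ} → s ≗S s' → (t : Tm Γ σ) → subT s t ≡ subT s' t
subT-cong e (var x) = e x
subT-cong e (con c) = refl
subT-cong e (f · a) = cong₂ _·_ (subT-cong e f) (subT-cong e a)

renT-as-subT : ∀ {Γ Δ σ} (r : Ren Γ Δ) (t : Tm Γ σ) → renT r t ≡ subT (ren→sub r) t
renT-as-subT r (var x) = refl
renT-as-subT r (con c) = refl
renT-as-subT r (f · a) = cong₂ _·_ (renT-as-subT r f) (renT-as-subT r a)

renT-renT : ∀ {Γ Δ Θ σ} (r : Ren Δ Θ) (r' : Ren Γ Δ) (t : Tm Γ σ) →
            renT r (renT r' t) ≡ renT (λ x → r (r' x)) t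
renT-renT r r' (var x) = refl
renT-renT r r' (con c) = refl
renT-renT r r' (f · a) = cong₂ _·_ (renT-renT r r' f) (renT-renT r r' a)

subT-renT : ∀ {Γ Δ Θ σ} (s : Sub Δ Θ) (r : Ren Γ Δ) (t : Tm Γ σ) →
            subT s (renT r t) ≡ subT (λ x → s (r x)) t
subT-renT s r (var x) = refl
subT-renT s r (con c) = refl
subT-renT s r (f · a) = cong₂ _·_ (subT-renT s r f) (subT-renT s r a)

renT-subT : ∀ {Γ Δ Θ σ} (r : Ren Δ Θ) (s : Sub Γ Δ) (t : Tm Γ σ) →
            renT r (subT s t) ≡ subT (λ x → renT r (s x)) t
renT-subT r s (var x) = refl
renT-subT r s (con c) = refl
renT-subT r s (f · a) = cong₂ _·_ (renT-subT r s f) (renT-subT r s a)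

subT-subT : ∀ {Γ Δ Θ σ} (s : Sub Δ Θ) (s' : Sub Γ Δ) (t : Tm Γ σ) →
            subT s (subT s' t) ≡ subT (λ x → subT s (s' x)) t
subT-subT s s' (var x) = refl
subT-subT s s' (con c) = refl
subT-subT s s' (f · a) = cong₂ _·_ (subT-subT s s' f) (subT-subT s s' a)

subT-var : ∀ {Γ σ} (t : Tm Γ σ) → subT var t ≡ t
subT-var (var x) = refl
subT-var (con c) = refl
subT-var (f · a) = cong₂ _·_ (subT-var f) (subT-var a)

sub0-wkT : ∀ {Γ σ τ} (a : Tm Γ σ) (t : Tm Γ τ) → subT (sub0 a) (wkT t) ≡ t
sub0-wkT a t = trans (subT-renT (sub0 a) there t) (subT-var t)

liftS-wkT : ∀ {Γ Δ σ τ} (s : Sub Γ Δ) (t : Tm Γ τ) → subT (liftS {τ = σ} s) (wkT t) ≡ wkT (subT s t)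
liftS-wkT s t = trans (subT-renT (liftS s) there t) (sym (renT-subT there s t))

liftS-liftS : ∀ {Γ Δ Θ τ} (s : Sub Δ Θ) (s' : Sub Γ Δ) →
              (λ {σ} (x : (τ ∷ Γ) ∋ σ) → subT (liftS s) (liftS s' x)) ≗S liftS (λ x → subT s (s' x))
liftS-liftS s s' here      = refl
liftS-liftS s s' (there x) = liftS-wkT s (s' x)

liftS-ren→sub : ∀ {Γ Δ τ} (r : Ren Γ Δ) → ren→sub (liftR {τ = τ} r) ≗S liftS (ren→sub r)
liftS-ren→sub r here      = refl
liftS-ren→sub r (there x) = refl

liftS-var : ∀ {Γ τ} → liftS {Γ} {Γ} {τ} var ≗S var
liftS-var here      = refl
liftS-var (there x) = refl

subF-cong : ∀ {Γ Δ} {s s' : Sub Γ Δ} → s ≗S s' → (φ : Fm Γ) → subF s φ ≡ subF s' φ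
subF-cong e (a ≐ b)   = cong₂ _≐_ (subT-cong e a) (subT-cong e b)
subF-cong e ⊥'        = refl
subF-cong e (φ ∧' ψ)  = cong₂ _∧'_ (subF-cong e φ) (subF-cong e ψ)
subF-cong e (φ ∨' ψ)  = cong₂ _∨'_ (subF-cong e φ) (subF-cong e ψ)
subF-cong e (φ ⊃ ψ)   = cong₂ _⊃_ (subF-cong e φ) (subF-cong e ψ)
subF-cong e (∀' σ φ)  = cong (∀' σ) (subF-cong (liftS-cong e) φ)
subF-cong e (∃' σ φ)  = cong (∃' σ) (subF-cong (liftS-cong e) φ)
subF-cong e (st t)    = cong st (subT-cong e t)
subF-cong e (∀st σ φ) = cong (∀st σ) (subF-cong (liftS-cong e) φ)
subF-cong e (∃st σ φ) = cong (∃st σ) (subF-cong (liftS-cong e) φ)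

renF-as-subF : ∀ {Γ Δ} (r : Ren Γ Δ) (φ : Fm Γ) → renF r φ ≡ subF (ren→sub r) φ
renF-as-subF r (a ≐ b)   = cong₂ _≐_ (renT-as-subT r a) (renT-as-subT r b)
renF-as-subF r ⊥'        = refl
renF-as-subF r (φ ∧' ψ)  = cong₂ _∧'_ (renF-as-subF r φ) (renF-as-subF r ψ)
renF-as-subF r (φ ∨' ψ)  = cong₂ _∨'_ (renF-as-subF r φ) (renF-as-subF r ψ)
renF-as-subF r (φ ⊃ ψ)   = cong₂ _⊃_ (renF-as-subF r φ) (renF-as-subF r ψ)
renF-as-subF r (∀' σ φ)  = cong (∀' σ) (trans (renF-as-subF (liftR r) φ) (subF-cong (liftS-ren→sub r) φ))
renF-as-subF r (∃' σ φ)  = cong (∃' σ) (trans (renF-as-subF (liftR r) φ) (subF-cong (liftS-ren→sub r) φ))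
renF-as-subF r (st t)    = cong st (renT-as-subT r t)
renF-as-subF r (∀st σ φ) = cong (∀st σ) (trans (renF-as-subF (liftR r) φ) (subF-cong (liftS-ren→sub r) φ))
renF-as-subF r (∃st σ φ) = cong (∃st σ) (trans (renF-as-subF (liftR r) φ) (subF-cong (liftS-ren→sub r) φ))

subF-subF : ∀ {Γ Δ Θ} (s : Sub Δ Θ) (s' : Sub Γ Δ) (φ : Fm Γ) →
            subF s (subF s' φ) ≡ subF (λ x → subT s (s' x)) φ
subF-subF s s' (a ≐ b)   = cong₂ _≐_ (subT-subT s s' a) (subT-subT s s' b)
subF-subF s s' ⊥'        = refl
subF-subF s s' (φ ∧' ψ)  = cong₂ _∧'_ (subF-subF s s' φ) (subF-subF s s' ψ)
subF-subF s s' (φ ∨' ψ)  = cong₂ _∨'_ (subF-subF s s' φ) (subF-subF s s' ψ)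
subF-subF s s' (φ ⊃ ψ)   = cong₂ _⊃_ (subF-subF s s' φ) (subF-subF s s' ψ)
subF-subF s s' (∀' σ φ)  = cong (∀' σ) (trans (subF-subF (liftS s) (liftS s') φ) (subF-cong (liftS-liftS s s') φ))
subF-subF s s' (∃' σ φ)  = cong (∃' σ) (trans (subF-subF (liftS s) (liftS s') φ) (subF-cong (liftS-liftS s s') φ))
subF-subF s s' (st t)    = cong st (subT-subT s s' t)
subF-subF s s' (∀st σ φ) = cong (∀st σ) (trans (subF-subF (liftS s) (liftS s') φ) (subF-cong (liftS-liftS s s') φ))
subF-subF s s' (∃st σ φ) = cong (∃st σ) (trans (subF-subF (liftS s) (liftS s') φ) (subF-cong (liftS-liftS s s') φ))

subF-var : ∀ {Γ} (φ : Fm Γ) → subF var φ ≡ φ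
subF-var (a ≐ b)   = cong₂ _≐_ (subT-var a) (subT-var b)
subF-var ⊥'        = refl
subF-var (φ ∧' ψ)  = cong₂ _∧'_ (subF-var φ) (subF-var ψ)
subF-var (φ ∨' ψ)  = cong₂ _∨'_ (subF-var φ) (subF-var ψ)
subF-var (φ ⊃ ψ)   = cong₂ _⊃_ (subF-var φ) (subF-var ψ)
subF-var (∀' σ φ)  = cong (∀' σ) (trans (subF-cong liftS-var φ) (subF-var φ))
subF-var (∃' σ φ)  = cong (∃' σ) (trans (subF-cong liftS-var φ) (subF-var φ))
subF-var (st t)    = cong st (subT-var t)
subF-var (∀st σ φ) = cong (∀st σ) (trans (subF-cong liftS-var φ) (subF-var φ))
subF-var (∃st σ φ) = cong (∃st σ) (trans (subF-cong liftS-var φ) (subF-var φ))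

subF-renF : ∀ {Γ Δ Θ} (s : Sub Δ Θ) (r : Ren Γ Δ) (φ : Fm Γ) → subF s (renF r φ) ≡ subF (λ x → s (r x)) φ
subF-renF s r φ = trans (cong (subF s) (renF-as-subF r φ)) (subF-subF s _ φ)

renF-subF : ∀ {Γ Δ Θ} (r : Ren Δ Θ) (s : Sub Γ Δ) (φ : Fm Γ) → renF r (subF s φ) ≡ subF (λ x → renT r (s x)) φ
renF-subF r s φ = trans (renF-as-subF r (subF s φ))
  (trans (subF-subF _ s φ) (subF-cong (λ x → sym (renT-as-subT r (s x))) φ))

renF-renF : ∀ {Γ Δ Θ} (r : Ren Δ Θ) (r' : Ren Γ Δ) (φ : Fm Γ) → renF r (renF r' φ) ≡ renF (λ x → r (r' x)) φ
renF-renF r r' φ = trans (cong (renF r) (renF-as-subF r' φ)) (trans (renF-subF r _ φ) (sym (renF-as-subF _ φ)))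

subF-liftR-there-[v0] : ∀ {Γ σ} (φ : Fm (σ ∷ Γ)) → renF (liftR there) φ [ var here ] ≡ φ
subF-liftR-there-[v0] φ = trans (subF-renF (sub0 (var here)) (liftR there) φ) (trans (subF-cong e φ) (subF-var φ))
  where
  e : (λ {τ} (x : _ ∋ τ) → sub0 (var here) (liftR there x)) ≗S var
  e here      = refl
  e (there x) = refl

Internal-subF : ∀ {Γ Δ} {φ : Fm Γ} (s : Sub Γ Δ) → Internal φ → Internal (subF s φ)
Internal-subF s i≐        = i≐
Internal-subF s i⊥        = i⊥
Internal-subF s (i∧ a b)  = i∧ (Internal-subF s a) (Internal-subF s b)
Internal-subF s (i∨ a b)  = i∨ (Internal-subF s a) (Internal-subF s b)
Internal-subF s (i⊃ a b)  = i⊃ (Internal-subF s a) (Internal-subF s b)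
Internal-subF s (i∀ a)    = i∀ (Internal-subF (liftS s) a)
Internal-subF s (i∃ a)    = i∃ (Internal-subF (liftS s) a)

zeroT-sub : ∀ {Γ Δ} (s : Sub Γ Δ) σ → subT s (zeroT σ) ≡ zeroT σ
zeroT-sub s 𝟘       = refl
zeroT-sub s (σ ⇒ τ) = cong (con cK ·_) (zeroT-sub s τ)
zeroT-sub s (σ *)   = refl

-- A copy of the step function of proj: it is a closed combinator, so substitution acts on
-- proj only through zeroT σ.
projStep : ∀ {Γ σ} → Tm Γ (σ ⇒ σ * ⇒ (𝟘 ⇒ σ) ⇒ 𝟘 ⇒ σ)
projStep = abs (abs (abs (abs
  (con cR · var (there (there (there here)))
          · abs (abs (var (there (there (there here))) · var (there here)))
          · var here))))

proj-sub : ∀ {Γ Δ σ} (s : Sub Γ Δ) → subT s (proj {σ = σ}) ≡ proj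
proj-sub {σ = σ} s = cong (λ z → con cL · (con cK · z) · projStep) (zeroT-sub s σ)

proj-ren : ∀ {Γ Δ σ} (r : Ren Γ Δ) → renT r (proj {σ = σ}) ≡ proj
proj-ren r = trans (renT-as-subT r proj) (proj-sub (ren→sub r))

lt-sub : ∀ {Γ Δ} (s : Sub Γ Δ) (a b : Tm Γ 𝟘) → subF s (lt a b) ≡ lt (subT s a) (subT s b)
lt-sub s a b = cong₂ (λ x y → ∃' 𝟘 (plus · x · (Sc · var here) ≐ y)) (liftS-wkT s a) (liftS-wkT s b)

Eq-sub : ∀ {Γ Δ} (s : Sub Γ Δ) τ (a b : Tm Γ τ) → subF s (Eq τ a b) ≡ Eq τ (subT s a) (subT s b)
Eq-sub s 𝟘       a b = refl
Eq-sub s (σ ⇒ τ) a b = cong (∀' σ) (trans (Eq-sub (liftS s) τ _ _)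
  (cong₂ (λ x y → Eq τ (x · var here) (y · var here)) (liftS-wkT s a) (liftS-wkT s b)))
Eq-sub s (σ *)   a b = cong₂ _∧'_ refl (cong (∀' 𝟘) (cong₂ _⊃_
  (trans (lt-sub (liftS s) (var here) (len · wkT a)) (cong (λ x → lt (var here) (len · x)) (liftS-wkT s a)))
  (trans (Eq-sub (liftS s) σ _ _)
    (cong₂ (λ x y → Eq σ (x · var here) (y · var here))
      (cong₂ _·_ (proj-sub (liftS s)) (liftS-wkT s a))
      (cong₂ _·_ (proj-sub (liftS s)) (liftS-wkT s b))))))

Eq-ren : ∀ {Γ Δ} (r : Ren Γ Δ) τ (a b : Tm Γ τ) → renF r (Eq τ a b) ≡ Eq τ (renT r a) (renT r b)
Eq-ren r τ a b = trans (renF-as-subF r (Eq τ a b))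
  (trans (Eq-sub _ τ a b) (sym (cong₂ (Eq τ) (renT-as-subT r a) (renT-as-subT r b))))

subSuc-wkT : ∀ {Γ τ} (t : Tm Γ τ) → subT subSuc (wkT t) ≡ wkT t
subSuc-wkT t = trans (subT-renT subSuc there t) (sym (renT-as-subT there t))

Prf : (Γ : Ctx) → List (Fm Γ) → Fm Γ → Set
Prf = Pf EHAstI

base : ∀ {Γ Δ φ} → BaseAx Γ φ → Prf Γ Δ φ
base a = ax (inj₁ a)

idealization : ∀ {Γ Δ} (σ τ : Ty) (φ : Fm (σ ∷ τ ∷ Γ)) → Internal φ → Prf Γ Δ (IFormula σ τ φ)
idealization σ τ φ i = ax (inj₂ (ideal σ τ φ i))

h0 : ∀ {Γ} {φ : Fm Γ} {Δ} → φ ∈ (φ ∷ Δ)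
h0 = here refl

h1 : ∀ {Γ} {φ ψ : Fm Γ} {Δ} → φ ∈ (ψ ∷ φ ∷ Δ)
h1 = there h0

h2 : ∀ {Γ} {φ ψ χ : Fm Γ} {Δ} → φ ∈ (χ ∷ ψ ∷ φ ∷ Δ)
h2 = there h1

h3 : ∀ {Γ} {φ ψ χ ω : Fm Γ} {Δ} → φ ∈ (ω ∷ χ ∷ ψ ∷ φ ∷ Δ)
h3 = there h2

v0 : ∀ {Γ σ} → Tm (σ ∷ Γ) σ
v0 = var here

v1 : ∀ {Γ σ τ} → Tm (τ ∷ σ ∷ Γ) σ
v1 = var (there here)

v2 : ∀ {Γ σ τ ρ} → Tm (ρ ∷ τ ∷ σ ∷ Γ) σ
v2 = var (there (there here))

v3 : ∀ {Γ σ τ ρ ω} → Tm (ω ∷ ρ ∷ τ ∷ σ ∷ Γ) σ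
v3 = var (there (there (there here)))

v4 : ∀ {Γ σ τ ρ ω κ} → Tm (κ ∷ ω ∷ ρ ∷ τ ∷ σ ∷ Γ) σ
v4 = var (there (there (there (there here))))

memWith : ∀ {Γ σ} → Tm Γ (σ * ⇒ 𝟘 ⇒ σ) → Tm Γ σ → Tm Γ (σ *) → Fm Γ
memWith {σ = σ} p x L = ∃' 𝟘 (lt v0 (len · wkT L) ∧' Eq σ (wkT x) (wkT p · wkT L · v0))

subF-memWith : ∀ {Γ Δ σ} (s : Sub Γ Δ) (p : Tm Γ (σ * ⇒ 𝟘 ⇒ σ)) (x : Tm Γ σ) (L : Tm Γ (σ *)) →
               subF s (memWith p x L) ≡ memWith (subT s p) (subT s x) (subT s L)
subF-memWith {σ = σ} s p x L = cong (∃' 𝟘) (cong₂ _∧'_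
  (trans (lt-sub (liftS s) v0 (len · wkT L)) (cong (λ z → lt v0 (len · z)) (liftS-wkT s L)))
  (trans (Eq-sub (liftS s) σ _ _) (cong₂ (Eq σ) (liftS-wkT s x)
    (cong₂ (λ q z → q · z · v0) (liftS-wkT s p) (liftS-wkT s L)))))

infix 4 _⊆_

_⊆_ : ∀ {Γ} → List (Fm Γ) → List (Fm Γ) → Set
Δ ⊆ Δ' = ∀ {φ} → φ ∈ Δ → φ ∈ Δ'

map-∈ : ∀ {Γ Γ'} (f : Fm Γ → Fm Γ') {φ} {Δ : List (Fm Γ)} → φ ∈ Δ → f φ ∈ map f Δ
map-∈ f (here refl) = here refl
map-∈ f (there m)   = there (map-∈ f m)

map-⊆ : ∀ {Γ Γ'} (f : Fm Γ → Fm Γ') {Δ Δ' : List (Fm Γ)} → Δ ⊆ Δ' → map f Δ ⊆ map f Δ'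
map-⊆ f {φ ∷ Δ} s (here refl) = map-∈ f (s h0)
map-⊆ f {φ ∷ Δ} s (there m)   = map-⊆ f (λ m' → s (there m')) m

∷-⊆ : ∀ {Γ} {Δ Δ' : List (Fm Γ)} {φ} → Δ ⊆ Δ' → φ ∷ Δ ⊆ φ ∷ Δ'
∷-⊆ s (here e)  = here e
∷-⊆ s (there m) = there (s m)

weaken : ∀ {Γ Δ Δ' φ} → Δ ⊆ Δ' → Prf Γ Δ φ → Prf Γ Δ' φ
weaken s (ax a)     = ax a
weaken s (hyp m)    = hyp (s m)
weaken s (⊥E p)     = ⊥E (weaken s p)
weaken s (∧I p q)   = ∧I (weaken s p) (weaken s q)
weaken s (∧E₁ p)    = ∧E₁ (weaken s p)
weaken s (∧E₂ p)    = ∧E₂ (weaken s p)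
weaken s (∨I₁ p)    = ∨I₁ (weaken s p)
weaken s (∨I₂ p)    = ∨I₂ (weaken s p)
weaken s (∨E p q r) = ∨E (weaken s p) (weaken (∷-⊆ s) q) (weaken (∷-⊆ s) r)
weaken s (⊃I p)     = ⊃I (weaken (∷-⊆ s) p)
weaken s (⊃E p q)   = ⊃E (weaken s p) (weaken s q)
weaken s (∀I p)     = ∀I (weaken (map-⊆ wkF s) p)
weaken s (∀E p t)   = ∀E (weaken s p) t
weaken s (∃I t p)   = ∃I t (weaken s p)
weaken s (∃E p q)   = ∃E (weaken s p) (weaken (∷-⊆ (map-⊆ wkF s)) q)

weaken₁ : ∀ {Γ Δ φ ψ} → Prf Γ Δ φ → Prf Γ (ψ ∷ Δ) φ
weaken₁ = weaken there

hyp-wk : ∀ {Γ τ Δ} {φ : Fm Γ} → φ ∈ Δ → Prf (τ ∷ Γ) (map wkF Δ) (wkF φ)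
hyp-wk m = hyp (map-∈ wkF m)

⊃E₂ : ∀ {Γ Δ φ ψ χ} → Prf Γ Δ (φ ⊃ ψ ⊃ χ) → Prf Γ Δ φ → Prf Γ Δ ψ → Prf Γ Δ χ
⊃E₂ p q r = ⊃E (⊃E p q) r

sub2 : ∀ {Γ α β} → Tm Γ α → Tm Γ β → Sub (β ∷ α ∷ Γ) Γ
sub2 a b here              = b
sub2 a b (there here)      = a
sub2 a b (there (there x)) = var x

∀E₂ : ∀ {Γ Δ α β} {φ : Fm (β ∷ α ∷ Γ)} → Prf Γ Δ (∀' α (∀' β φ)) → (a : Tm Γ α) (b : Tm Γ β) →
      Prf Γ Δ (subF (sub2 a b) φ)
∀E₂ {φ = φ} p a b = subst (Prf _ _) (trans (subF-subF (sub0 b) (liftS (sub0 a)) φ) (subF-cong e φ)) (∀E (∀E p a) b)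
  where
  e : (λ {τ} (x : _ ∋ τ) → subT (sub0 b) (liftS (sub0 a) x)) ≗S sub2 a b
  e here              = refl
  e (there here)      = sub0-wkT b a
  e (there (there x)) = refl

sub3 : ∀ {Γ α β γ} → Tm Γ α → Tm Γ β → Tm Γ γ → Sub (γ ∷ β ∷ α ∷ Γ) Γ
sub3 a b c here                      = c
sub3 a b c (there here)              = b
sub3 a b c (there (there here))      = a
sub3 a b c (there (there (there x))) = var x

∀E₃ : ∀ {Γ Δ α β γ} {φ : Fm (γ ∷ β ∷ α ∷ Γ)} → Prf Γ Δ (∀' α (∀' β (∀' γ φ))) →
      (a : Tm Γ α) (b : Tm Γ β) (c : Tm Γ γ) → Prf Γ Δ (subF (sub3 a b c) φ)
∀E₃ {φ = φ} p a b c = subst (Prf _ _) (trans (subF-subF (sub0 c) (liftS (sub2 a b)) φ) (subF-cong e φ)) (∀E (∀E₂ p a b) c)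
  where
  e : (λ {τ} (x : _ ∋ τ) → subT (sub0 c) (liftS (sub2 a b) x)) ≗S sub3 a b c
  e here                      = refl
  e (there here)              = sub0-wkT c b
  e (there (there here))      = sub0-wkT c a
  e (there (there (there x))) = refl

∀stE : ∀ {Γ Δ τ} {φ : Fm (τ ∷ Γ)} → Prf Γ Δ (∀st τ φ) → (t : Tm Γ τ) → Prf Γ Δ (st t) → Prf Γ Δ (φ [ t ])
∀stE p t q = ⊃E (∀E (⊃E (base (∀st→ _)) p) t) q

∀stI : ∀ {Γ Δ τ} {φ : Fm (τ ∷ Γ)} → Prf (τ ∷ Γ) (st v0 ∷ map wkF Δ) φ → Prf Γ Δ (∀st τ φ)
∀stI p = ⊃E (base (∀st← _)) (∀I (⊃I p))

st-app : ∀ {Γ Δ σ τ} {f : Tm Γ (σ ⇒ τ)} {x : Tm Γ σ} → Prf Γ Δ (st f) → Prf Γ Δ (st x) → Prf Γ Δ (st (f · x))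
st-app p q = ⊃E (base (stApp _ _)) (∧I p q)

st-closed : ∀ {Γ Δ σ} (t : Tm [] σ) → Prf Γ Δ (st (closedT t))
st-closed t = base (stClos t)

Eq-refl : ∀ {Γ Δ} τ (t : Tm Γ τ) → Prf Γ Δ (Eq τ t t)
Eq-refl 𝟘       t = base (eqRefl t)
Eq-refl (σ ⇒ τ) t = ∀I (Eq-refl τ _)
Eq-refl (σ *)   t = ∧I (base (eqRefl _)) (∀I (⊃I (Eq-refl σ _)))

·-congʳ : ∀ {Γ Δ σ τ} {f g : Tm Γ (σ ⇒ τ)} → Prf Γ Δ (Eq (σ ⇒ τ) f g) → (a : Tm Γ σ) →
          Prf Γ Δ (Eq τ (f · a) (g · a))
·-congʳ {τ = τ} {f} {g} p a = subst (Prf _ _) eq (∀E p a)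
  where
  eq : subF (sub0 a) (Eq τ (wkT f · v0) (wkT g · v0)) ≡ Eq τ (f · a) (g · a)
  eq = trans (Eq-sub (sub0 a) τ _ _) (cong₂ (λ x y → Eq τ (x · a) (y · a)) (sub0-wkT a f) (sub0-wkT a g))

·-congˡ : ∀ {Γ Δ σ τ} (u : Tm Γ (σ ⇒ τ)) {a b : Tm Γ σ} → Prf Γ Δ (Eq σ a b) → Prf Γ Δ (Eq τ (u · a) (u · b))
·-congˡ u p = ⊃E (base (ext u _ _)) p

hyp-wkEq : ∀ {Γ τ Δ} σ {a b : Tm Γ σ} → Eq σ a b ∈ Δ → Prf (τ ∷ Γ) (map wkF Δ) (Eq σ (wkT a) (wkT b))
hyp-wkEq σ {a} {b} m = subst (Prf _ _) (Eq-ren there σ a b) (hyp-wk m)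

≐-subst : ∀ {Γ Δ} (φ : Fm (𝟘 ∷ Γ)) → Internal φ → {s t : Tm Γ 𝟘} →
          Prf Γ Δ (s ≐ t) → Prf Γ Δ (φ [ s ]) → Prf Γ Δ (φ [ t ])
≐-subst φ i p q = ⊃E₂ (base (eqSubst φ i _ _)) p q

≐-trans : ∀ {Γ Δ} {a b c : Tm Γ 𝟘} → Prf Γ Δ (a ≐ b) → Prf Γ Δ (b ≐ c) → Prf Γ Δ (a ≐ c)
≐-trans {a = a} {b} {c} p q =
  subst (Prf _ _) (cong (_≐ c) (sub0-wkT c a))
    (≐-subst (wkT a ≐ v0) i≐ q (subst (Prf _ _) (cong (_≐ b) (sym (sub0-wkT b a))) p))

≐-sym : ∀ {Γ Δ} {a b : Tm Γ 𝟘} → Prf Γ Δ (a ≐ b) → Prf Γ Δ (b ≐ a)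
≐-sym {a = a} {b} p =
  subst (Prf _ _) (cong (b ≐_) (sub0-wkT b a))
    (≐-subst (v0 ≐ wkT a) i≐ p (subst (Prf _ _) (cong (a ≐_) (sym (sub0-wkT a a))) (base (eqRefl a))))

lt-respʳ : ∀ {Γ Δ} {i n m : Tm Γ 𝟘} → Prf Γ Δ (n ≐ m) → Prf Γ Δ (lt i n) → Prf Γ Δ (lt i m)
lt-respʳ {i = i} {n} {m} p q =
  subst (Prf _ _) (e m) (≐-subst (lt (wkT i) v0) (i∃ i≐) p (subst (Prf _ _) (sym (e n)) q))
  where
  e : ∀ k → lt (wkT i) v0 [ k ] ≡ lt i k
  e k = trans (lt-sub (sub0 k) (wkT i) v0) (cong (λ x → lt x k) (sub0-wkT k i))

Eq-at : ∀ {Γ Δ σ} {s t : Tm Γ (σ *)} → Prf Γ Δ (Eq (σ *) s t) → (i : Tm Γ 𝟘) → Prf Γ Δ (lt i (len · s)) →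
        Prf Γ Δ (Eq σ (proj · s · i) (proj · t · i))
Eq-at {σ = σ} {s} {t} p i q = ⊃E (subst (Prf _ _) eq (∀E (∧E₂ p) i)) q
  where
  eq : subF (sub0 i) (lt v0 (len · wkT s) ⊃ Eq σ (proj · wkT s · v0) (proj · wkT t · v0))
       ≡ (lt i (len · s) ⊃ Eq σ (proj · s · i) (proj · t · i))
  eq = cong₂ _⊃_
    (trans (lt-sub (sub0 i) v0 (len · wkT s)) (cong (λ x → lt i (len · x)) (sub0-wkT i s)))
    (trans (Eq-sub (sub0 i) σ _ _) (cong₂ (λ x y → Eq σ (x · i) (y · i))
      (cong₂ _·_ (proj-sub (sub0 i)) (sub0-wkT i s)) (cong₂ _·_ (proj-sub (sub0 i)) (sub0-wkT i t))))

-- Symmetry and transitivity of Eq are proved as implications, so that the induction on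
-- the type can use the weakened hypotheses under the binders of Eq.
Eq-trans⊃ : ∀ {Γ Δ} τ (a b c : Tm Γ τ) → Prf Γ Δ (Eq τ a b ⊃ Eq τ b c ⊃ Eq τ a c)
Eq-trans⊃ 𝟘       a b c = ⊃I (⊃I (≐-trans (hyp h1) (hyp h0)))
Eq-trans⊃ (σ ⇒ τ) a b c = ⊃I (⊃I (∀I (⊃E₂ (Eq-trans⊃ τ _ _ _)
  (·-congʳ (hyp-wkEq (σ ⇒ τ) h1) v0) (·-congʳ (hyp-wkEq (σ ⇒ τ) h0) v0))))
Eq-trans⊃ {Γ} {Δ} (σ *) a b c = ⊃I (⊃I (∧I (≐-trans (∧E₁ (hyp h1)) (∧E₁ (hyp h0)))
  (∀I (⊃I (⊃E₂ (Eq-trans⊃ σ _ _ _) (Eq-at a=b v0 (hyp h0)) (Eq-at b=c v0 (lt-respʳ (∧E₁ a=b) (hyp h0))))))))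
  where
  Δ' : List (Fm (𝟘 ∷ Γ))
  Δ' = lt v0 (len · wkT a) ∷ map wkF (Eq (σ *) b c ∷ Eq (σ *) a b ∷ Δ)
  a=b : Prf (𝟘 ∷ Γ) Δ' (Eq (σ *) (wkT a) (wkT b))
  a=b = weaken₁ (hyp-wkEq (σ *) h1)
  b=c : Prf (𝟘 ∷ Γ) Δ' (Eq (σ *) (wkT b) (wkT c))
  b=c = weaken₁ (hyp-wkEq (σ *) h0)

Eq-trans : ∀ {Γ Δ τ} {a b c : Tm Γ τ} → Prf Γ Δ (Eq τ a b) → Prf Γ Δ (Eq τ b c) → Prf Γ Δ (Eq τ a c)
Eq-trans {τ = τ} p q = ⊃E₂ (Eq-trans⊃ τ _ _ _) p q

Eq-sym⊃ : ∀ {Γ Δ} τ (a b : Tm Γ τ) → Prf Γ Δ (Eq τ a b ⊃ Eq τ b a)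
Eq-sym⊃ 𝟘       a b = ⊃I (≐-sym (hyp h0))
Eq-sym⊃ (σ ⇒ τ) a b = ⊃I (∀I (⊃E (Eq-sym⊃ τ _ _) (·-congʳ (hyp-wkEq (σ ⇒ τ) h0) v0)))
Eq-sym⊃ {Γ} {Δ} (σ *) a b = ⊃I (∧I (≐-sym (∧E₁ (hyp h0)))
  (∀I (⊃I (⊃E (Eq-sym⊃ σ _ _) (Eq-at a=b v0 (lt-respʳ (≐-sym (∧E₁ a=b)) (hyp h0)))))))
  where
  a=b : Prf (𝟘 ∷ Γ) (lt v0 (len · wkT b) ∷ map wkF (Eq (σ *) a b ∷ Δ)) (Eq (σ *) (wkT a) (wkT b))
  a=b = weaken₁ (hyp-wkEq (σ *) h0)

Eq-sym : ∀ {Γ Δ τ} {a b : Tm Γ τ} → Prf Γ Δ (Eq τ a b) → Prf Γ Δ (Eq τ b a)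
Eq-sym {τ = τ} p = ⊃E (Eq-sym⊃ τ _ _) p

st-Eq : ∀ {Γ Δ σ} {x y : Tm Γ σ} → Prf Γ Δ (st x) → Prf Γ Δ (Eq σ x y) → Prf Γ Δ (st y)
st-Eq p q = ⊃E (base (stEq _ _)) (∧I p q)

-- Two substitutions agree under Δ if at each variable they coincide or their values are
-- hypothesised equal in Δ (in both orders, as both directions of Leibniz are needed).
Agree : ∀ {Θ Γ} → List (Fm Γ) → Sub Θ Γ → Sub Θ Γ → Set
Agree {Θ} Δ s t = ∀ {τ} (x : Θ ∋ τ) → (s x ≡ t x) ⊎ (Eq τ (s x) (t x) ∈ Δ × Eq τ (t x) (s x) ∈ Δ)

Agree-sym : ∀ {Θ Γ} {Δ : List (Fm Γ)} {s t : Sub Θ Γ} → Agree Δ s t → Agree Δ t s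
Agree-sym A x with A x
... | inj₁ e       = inj₁ (sym e)
... | inj₂ (p , q) = inj₂ (q , p)

Agree-weaken : ∀ {Θ Γ} {Δ Δ' : List (Fm Γ)} {s t : Sub Θ Γ} → Δ ⊆ Δ' → Agree Δ s t → Agree Δ' s t
Agree-weaken w A x with A x
... | inj₁ e       = inj₁ e
... | inj₂ (p , q) = inj₂ (w p , w q)

Agree-lift : ∀ {Θ Γ ρ} {Δ : List (Fm Γ)} {s t : Sub Θ Γ} → Agree Δ s t → Agree (map (wkF {τ = ρ}) Δ) (liftS s) (liftS t)
Agree-lift A here = inj₁ refl
Agree-lift {Δ = Δ} {s} {t} A {τ} (there x) with A x
... | inj₁ e       = inj₁ (cong wkT e)
... | inj₂ (p , q) = inj₂ (subst (_∈ map wkF Δ) (Eq-ren there τ (s x) (t x)) (map-∈ wkF p) ,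
                           subst (_∈ map wkF Δ) (Eq-ren there τ (t x) (s x)) (map-∈ wkF q))

Eq-subT : ∀ {Θ Γ ρ} {Δ : List (Fm Γ)} {s t : Sub Θ Γ} (u : Tm Θ ρ) → Agree Δ s t → Prf Γ Δ (Eq ρ (subT s u) (subT t u))
Eq-subT {ρ = ρ} {s = s} (var x) A with A x
... | inj₁ e       = subst (λ z → Prf _ _ (Eq ρ (s x) z)) e (Eq-refl ρ (s x))
... | inj₂ (p , q) = hyp p
Eq-subT (con c) A = Eq-refl _ _
Eq-subT {s = s} {t} (f · a) A = Eq-trans (·-congʳ (Eq-subT f A) (subT s a)) (·-congˡ (subT t f) (Eq-subT a A))

leibniz-subF : ∀ {Θ Γ} {Δ : List (Fm Γ)} {s t : Sub Θ Γ} (φ : Fm Θ) → Internal φ → Agree Δ s t →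
               Prf Γ Δ (subF s φ ⊃ subF t φ)
leibniz-subF {Δ = Δ} {s} {t} (a ≐ b) i≐ A =
  ⊃I (≐-trans (Eq-subT a (Agree-sym A')) (≐-trans (hyp h0) (Eq-subT b A')))
  where
  A' : Agree (subF s (a ≐ b) ∷ Δ) s t
  A' = Agree-weaken there A
leibniz-subF ⊥' i⊥ A = ⊃I (hyp h0)
leibniz-subF {Δ = Δ} {s} {t} (φ ∧' ψ) (i∧ iφ iψ) A =
  ⊃I (∧I (⊃E (leibniz-subF φ iφ A') (∧E₁ (hyp h0))) (⊃E (leibniz-subF ψ iψ A') (∧E₂ (hyp h0))))
  where
  A' : Agree (subF s (φ ∧' ψ) ∷ Δ) s t
  A' = Agree-weaken there A
leibniz-subF (φ ∨' ψ) (i∨ iφ iψ) A =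
  ⊃I (∨E (hyp h0) (∨I₁ (⊃E (leibniz-subF φ iφ (Agree-weaken (λ m → there (there m)) A)) (hyp h0)))
                  (∨I₂ (⊃E (leibniz-subF ψ iψ (Agree-weaken (λ m → there (there m)) A)) (hyp h0))))
leibniz-subF {Δ = Δ} {s} {t} (φ ⊃ ψ) (i⊃ iφ iψ) A =
  ⊃I (⊃I (⊃E (leibniz-subF ψ iψ A') (⊃E (hyp h1) (⊃E (leibniz-subF φ iφ (Agree-sym A')) (hyp h0)))))
  where
  A' : Agree (subF t φ ∷ subF s (φ ⊃ ψ) ∷ Δ) s t
  A' = Agree-weaken (λ m → there (there m)) A
leibniz-subF {s = s} (∀' ρ φ) (i∀ iφ) A =
  ⊃I (∀I (⊃E (leibniz-subF φ iφ (Agree-weaken there (Agree-lift A)))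
             (subst (Prf _ _) (subF-liftR-there-[v0] (subF (liftS s) φ)) (∀E (hyp-wk h0) v0))))
leibniz-subF {t = t} (∃' ρ φ) (i∃ iφ) A =
  ⊃I (∃E (hyp h0) (∃I v0 (subst (Prf _ _) (sym (subF-liftR-there-[v0] (subF (liftS t) φ)))
    (⊃E (leibniz-subF φ iφ (Agree-weaken (λ m → there (there m)) (Agree-lift A))) (hyp h0)))))

_▸_ : ∀ {Γ Γ' σ} → Tm Γ' σ → Ren Γ Γ' → Sub (σ ∷ Γ) Γ'
(u ▸ r) here      = u
(u ▸ r) (there x) = var (r x)

inst : ∀ {Γ Γ' σ} → Fm (σ ∷ Γ) → Ren Γ Γ' → Tm Γ' σ → Fm Γ'
inst χ r u = subF (u ▸ r) χ

leibniz : ∀ {Γ Γ' σ Δ} (χ : Fm (σ ∷ Γ)) → Internal χ → (r : Ren Γ Γ') {a b : Tm Γ' σ} →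
          Prf Γ' Δ (Eq σ a b) → Prf Γ' Δ (inst χ r a) → Prf Γ' Δ (inst χ r b)
leibniz χ iχ r p q = ⊃E₂ (⊃I (⊃I (⊃E (leibniz-subF χ iχ A) (weaken₁ (weaken₁ q))))) p (Eq-sym p)
  where
  A : Agree _ _ _
  A here      = inj₂ (h1 , h0)
  A (there x) = inj₁ refl

subF-inst : ∀ {Γ Γ₁ Γ₂ σ} (χ : Fm (σ ∷ Γ)) (r : Ren Γ Γ₁) (r' : Ren Γ Γ₂) (s : Sub Γ₁ Γ₂) (t : Tm Γ₁ σ) →
            (∀ {τ} (x : Γ ∋ τ) → s (r x) ≡ var (r' x)) → subF s (inst χ r t) ≡ inst χ r' (subT s t)
subF-inst χ r r' s t h = trans (subF-subF s (t ▸ r) χ) (subF-cong e χ)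
  where
  e : (λ {τ} x → subT s ((t ▸ r) {τ} x)) ≗S (subT s t ▸ r')
  e here      = refl
  e (there x) = h x

renF-inst : ∀ {Γ Γ₁ Γ₂ σ} (χ : Fm (σ ∷ Γ)) (r : Ren Γ Γ₁) (q : Ren Γ₁ Γ₂) (t : Tm Γ₁ σ) →
            renF q (inst χ r t) ≡ inst χ (λ x → q (r x)) (renT q t)
renF-inst χ r q t = trans (renF-subF q (t ▸ r) χ) (subF-cong e χ)
  where
  e : (λ {τ} x → renT q ((t ▸ r) {τ} x)) ≗S (renT q t ▸ (λ x → q (r x)))
  e here      = refl
  e (there x) = refl

Reduct : ∀ {Γ τ} → Tm Γ τ → Set
Reduct {Γ} {τ} t = Σ (Tm Γ τ) (λ u → ∀ {Δ} → Prf Γ Δ (Eq τ t u))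

contract : ∀ {Γ σ τ} (f : Tm Γ (σ ⇒ τ)) (a : Tm Γ σ) → Maybe (Reduct (f · a))
contract (con cK · x)       a              = just (x , base (axK x a))
contract (con cΣ · x · y)   a              = just (x · a · (y · a) , base (axΣ x y a))
contract (con cR · b · g)   (con cZ)       = just (b , base (axR0 b g))
contract (con cR · b · g)   (con cS · n)   = just (g · n · (con cR · b · g · n) , base (axRS b g n))
contract (con cL · b · g)   (con cε)       = just (b , base (axL0 b g))
contract (con cL · b · g)   (con cc · x · l) = just (g · x · l · (con cL · b · g · l) , base (axLc b g x l))
contract _                  _              = nothing

-- Reduction with fuel; every contraction is an instance of a defining axiom of T*, so terms
-- with the same reduct are provably equal.
normalise : ∀ {Γ τ} → ℕ → (t : Tm Γ τ) → Reduct t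
normalise zero t = t , Eq-refl _ _
normalise (suc n) (f · a) with normalise n f | normalise n a
... | f' , f=f' | a' , a=a' with contract f' a'
...   | nothing = f' · a' , Eq-trans (·-congʳ f=f' a) (·-congˡ f' a=a')
...   | just (r , f'a'=r) with normalise n r
...     | r' , r=r' = r' , Eq-trans (Eq-trans (Eq-trans (·-congʳ f=f' a) (·-congˡ f' a=a')) f'a'=r) r=r'
normalise (suc n) t = t , Eq-refl _ _

by-normalising : ∀ {Γ Δ τ} (fuel : ℕ) (t u : Tm Γ τ) →
                 proj₁ (normalise fuel t) ≡ proj₁ (normalise fuel u) → Prf Γ Δ (Eq τ t u)
by-normalising n t u e =
  Eq-trans (proj₂ (normalise n t)) (subst (λ z → Prf _ _ (Eq _ z u)) (sym e) (Eq-sym (proj₂ (normalise n u))))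

S' : ∀ {Γ} → Tm Γ 𝟘 → Tm Γ 𝟘
S' t = Sc · t

-- a + b in β-normal form; plus · a · b reduces to it
infixl 8 _+'_
_+'_ : ∀ {Γ} → Tm Γ 𝟘 → Tm Γ 𝟘 → Tm Γ 𝟘
a +' b = con cR · a · (con cK · Sc) · b

induction : ∀ {Γ Δ} (φ : Fm (𝟘 ∷ Γ)) → Internal φ →
            Prf Γ Δ (φ [ Z ]) → Prf Γ Δ (∀' 𝟘 (φ ⊃ subF subSuc φ)) → Prf Γ Δ (∀' 𝟘 φ)
induction φ i b s = ⊃E₂ (base (indInt φ i)) b s

S-cong : ∀ {Γ Δ} {a b : Tm Γ 𝟘} → Prf Γ Δ (a ≐ b) → Prf Γ Δ (S' a ≐ S' b)
S-cong p = ·-congˡ Sc p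

S-injective : ∀ {Γ Δ} {a b : Tm Γ 𝟘} → Prf Γ Δ (S' a ≐ S' b) → Prf Γ Δ (a ≐ b)
S-injective p = ⊃E (base (sucInj _ _)) p

S≢Z : ∀ {Γ Δ} {a : Tm Γ 𝟘} → Prf Γ Δ (S' a ≐ Z) → Prf Γ Δ ⊥'
S≢Z p = ⊃E (base (sucNZ _)) p

Z-or-S : ∀ {Γ Δ} → Prf Γ Δ (∀' 𝟘 (v0 ≐ Z ∨' ∃' 𝟘 (v1 ≐ S' v0)))
Z-or-S = induction _ (i∨ i≐ (i∃ i≐)) (∨I₁ (base (eqRefl _))) (∀I (⊃I (∨I₂ (∃I v0 (base (eqRefl _))))))

Z-or-≢Z : ∀ {Γ Δ} → Prf Γ Δ (∀' 𝟘 (v0 ≐ Z ∨' ¬' (v0 ≐ Z)))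
Z-or-≢Z = ∀I (∨E (∀E Z-or-S v0) (∨I₁ (hyp h0))
  (∨I₂ (∃E (hyp h0) (⊃I (S≢Z (≐-trans (≐-sym (hyp h1)) (hyp h0)))))))

+'-sucʳ : ∀ {Γ Δ} (a b : Tm Γ 𝟘) → Prf Γ Δ (a +' S' b ≐ S' (a +' b))
+'-sucʳ a b = ≐-trans (base (axRS _ _ _)) (·-congʳ (base (axK Sc b)) _)

+'-sucˡ : ∀ {Γ Δ} → Prf Γ Δ (∀' 𝟘 (∀' 𝟘 (S' v0 +' v1 ≐ S' (v0 +' v1))))
+'-sucˡ = induction _ (i∀ i≐) (∀I (by-normalising 10 _ _ refl))
  (∀I (⊃I (∀I (≐-trans (by-normalising 10 _ (S' (S' v0 +' v1)) refl)
                (≐-trans (S-cong (∀E (hyp-wk h0) v0)) (by-normalising 10 _ _ refl))))))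

+'-assoc : ∀ {Γ Δ} → Prf Γ Δ (∀' 𝟘 (∀' 𝟘 (∀' 𝟘 ((v1 +' v0) +' v2 ≐ v1 +' (v0 +' v2)))))
+'-assoc = induction _ (i∀ (i∀ i≐)) (∀I (∀I (by-normalising 10 _ _ refl)))
  (∀I (⊃I (∀I (∀I (≐-trans (by-normalising 10 _ (S' ((v1 +' v0) +' v2)) refl)
    (≐-trans (S-cong (∀E₂ (hyp (map-∈ wkF (map-∈ wkF h0))) v1 v0)) (by-normalising 10 _ _ refl)))))))

+'-congʳ : ∀ {Γ Δ} {a a' : Tm Γ 𝟘} (b : Tm Γ 𝟘) → Prf Γ Δ (a ≐ a') → Prf Γ Δ (a +' b ≐ a' +' b)
+'-congʳ {a = a} {a'} b p =
  subst (Prf _ _) (e a') (≐-subst (wkT a +' wkT b ≐ v0 +' wkT b) i≐ p (subst (Prf _ _) (sym (e a)) (base (eqRefl _))))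
  where
  e : ∀ t → (wkT a +' wkT b ≐ v0 +' wkT b) [ t ] ≡ (a +' b ≐ t +' b)
  e t = cong₂ (λ x y → x +' y ≐ t +' y) (sub0-wkT t a) (sub0-wkT t b)

plus-S≐S+' : ∀ {Γ Δ} → Prf Γ Δ (∀' 𝟘 (∀' 𝟘 (plus · v1 · S' v0 ≐ S' (v1 +' v0))))
plus-S≐S+' = ∀I (∀I (by-normalising 30 _ _ refl))

plus≐+' : ∀ {Γ Δ} (a b : Tm Γ 𝟘) → Prf Γ Δ (plus · a · S' b ≐ S' (a +' b))
plus≐+' a b = ∀E₂ plus-S≐S+' a b

≮Z : ∀ {Γ Δ} → Prf Γ Δ (∀' 𝟘 (lt v0 Z ⊃ ⊥'))
≮Z = ∀I (⊃I (∃E (hyp h0) (S≢Z (≐-trans (≐-sym (plus≐+' v1 v0)) (hyp h0)))))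

<S⇒<∨≐ : ∀ {Γ Δ} → Prf Γ Δ (∀' 𝟘 (∀' 𝟘 (lt v0 (S' v1) ⊃ (lt v0 v1 ∨' v0 ≐ v1))))
<S⇒<∨≐ = ∀I (∀I (⊃I (∃E (hyp h0) (∨E (∀E Z-or-S v0) k≐Z k≐S))))
  where
  k≐Z : ∀ {Γ Δ} → Prf (𝟘 ∷ 𝟘 ∷ 𝟘 ∷ Γ) (v0 ≐ Z ∷ plus · v1 · S' v0 ≐ S' v2 ∷ Δ) (lt v1 v2 ∨' v1 ≐ v2)
  k≐Z = ∨I₂ (≐-trans (≐-sym (base (axR0 v1 _)))
    (≐-trans (·-congˡ (con cR · v1 · (con cK · Sc)) (≐-sym (hyp h0)))
      (S-injective (≐-trans (≐-sym (plus≐+' v1 v0)) (hyp h1)))))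
  k≐S : ∀ {Γ Δ} → Prf (𝟘 ∷ 𝟘 ∷ 𝟘 ∷ Γ) (∃' 𝟘 (v1 ≐ S' v0) ∷ plus · v1 · S' v0 ≐ S' v2 ∷ Δ) (lt v1 v2 ∨' v1 ≐ v2)
  k≐S = ∃E (hyp h0) (∨I₁ (∃I v0
    (≐-trans (plus≐+' v2 v0) (≐-trans (≐-sym (+'-sucʳ v2 v0))
      (≐-trans (·-congˡ (con cR · v2 · (con cK · Sc)) (≐-sym (hyp h0)))
        (S-injective (≐-trans (≐-sym (plus≐+' v2 v1)) (hyp (there (map-∈ wkF h1))))))))))

infix 7 _≺_

-- a ≺ b is a < b with slack on both sides, the shape in which a summand sits inside a sum.
_≺_ : ∀ {Γ} → Tm Γ 𝟘 → Tm Γ 𝟘 → Fm Γ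
a ≺ b = ∃' 𝟘 (∃' 𝟘 ((v1 +' S' (wkT (wkT a))) +' v0 ≐ wkT (wkT b)))

Internal-≺ : ∀ {Γ} {a b : Tm Γ 𝟘} → Internal (a ≺ b)
Internal-≺ = i∃ (i∃ i≐)

+'-S-+' : ∀ {Γ Δ} (k y k' : Tm Γ 𝟘) → Prf Γ Δ ((k +' S' y) +' k' ≐ S' ((k +' y) +' k'))
+'-S-+' k y k' = ≐-trans (+'-congʳ k' (+'-sucʳ k y)) (∀E₂ +'-sucˡ k' (k +' y))

S[k+'y+'k']≢y : ∀ {Γ Δ} → Prf Γ Δ (∀' 𝟘 (∀' 𝟘 (∀' 𝟘 (¬' (S' ((v1 +' v2) +' v0) ≐ v2)))))
S[k+'y+'k']≢y = induction _ (i∀ (i∀ (i⊃ i≐ i⊥))) (∀I (∀I (⊃I (S≢Z (hyp h0)))))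
  (∀I (⊃I (∀I (∀I (⊃I (⊃E (∀E₂ (hyp (there (map-∈ wkF (map-∈ wkF h0)))) v1 v0)
    (≐-trans (≐-sym (+'-S-+' v1 v2 v0)) (S-injective (hyp h0)))))))))

≺-irrefl : ∀ {Γ Δ} → Prf Γ Δ (∀' 𝟘 (v0 ≺ v0 ⊃ ⊥'))
≺-irrefl = ∀I (⊃I (∃E (hyp h0) (∃E (hyp h0)
  (⊃E (∀E₃ S[k+'y+'k']≢y v2 v1 v0) (≐-trans (≐-sym (+'-S-+' v1 v2 v0)) (hyp h0))))))

-- bound f n = Σ_{i<n} S(f i); the step function is λ i acc. plus acc (S (f i)) as a combinator.
bound : ∀ {Γ} → Tm Γ (𝟘 ⇒ 𝟘) → Tm Γ 𝟘 → Tm Γ 𝟘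
bound {Γ} f n = con cR · Z · step · n
  where
  step : Tm Γ (𝟘 ⇒ 𝟘 ⇒ 𝟘)
  step = con cΣ · (con cK · (con cΣ · plus)) · (con cΣ · (con cK · con cK) · (con cΣ · (con cK · Sc) · f))

bound-S : ∀ {Γ Δ} → Prf Γ Δ (∀' (𝟘 ⇒ 𝟘) (∀' 𝟘 (bound v1 v0 +' S' (v1 · v0) ≐ bound v1 (S' v0))))
bound-S = ∀I (∀I (by-normalising 12 _ _ refl))

≺-bound : ∀ {Γ Δ} → Prf Γ Δ (∀' (𝟘 ⇒ 𝟘) (∀' 𝟘 (∀' 𝟘 (lt v0 v1 ⊃ v2 · v0 ≺ bound v2 v1))))
≺-bound = ∀I (induction _ (i∀ (i⊃ (i∃ i≐) Internal-≺))
  (∀I (⊃I (⊥E (⊃E (∀E ≮Z v0) (hyp h0)))))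
  (∀I (⊃I (∀I (⊃I (∨E (⊃E (∀E₂ <S⇒<∨≐ v1 v0) (hyp h0)) i<n i≐n))))))
  where
  i<n : ∀ {Γ Δ} {φ : Fm (𝟘 ∷ 𝟘 ∷ (𝟘 ⇒ 𝟘) ∷ Γ)} →
        Prf (𝟘 ∷ 𝟘 ∷ (𝟘 ⇒ 𝟘) ∷ Γ) (lt v0 v1 ∷ φ ∷ ∀' 𝟘 (lt v0 v2 ⊃ v3 · v0 ≺ bound v3 v2) ∷ Δ)
          (v2 · v0 ≺ bound v2 (S' v1))
  i<n = ∃E (⊃E (∀E (hyp h2) v0) (hyp h0)) (∃E (hyp h0) (∃I v1 (∃I (v0 +' S' (v4 · v3))
    (≐-trans (≐-sym (∀E₃ +'-assoc (S' (v4 · v3)) (v1 +' S' (v4 · v2)) v0))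
      (≐-trans (+'-congʳ _ (hyp h0)) (∀E₂ bound-S v4 v3))))))
  i≐n : ∀ {Γ Δ} {φ ψ : Fm (𝟘 ∷ 𝟘 ∷ (𝟘 ⇒ 𝟘) ∷ Γ)} →
        Prf (𝟘 ∷ 𝟘 ∷ (𝟘 ⇒ 𝟘) ∷ Γ) (v0 ≐ v1 ∷ φ ∷ ψ ∷ Δ) (v2 · v0 ≺ bound v2 (S' v1))
  i≐n = ≐-subst (v3 · v0 ≺ bound v3 (S' v2)) Internal-≺ (≐-sym (hyp h0))
    (∃I (bound v2 v1) (∃I Z (≐-trans (base (axR0 _ _)) (∀E₂ bound-S v2 v1))))

≺-bound-enumerated : ∀ {Γ Δ} →
  Prf Γ Δ (∀' (𝟘 * ⇒ 𝟘 ⇒ 𝟘) (∀' (𝟘 *) (∃' 𝟘 (∀' 𝟘 (memWith v3 v0 v2 ⊃ v0 ≺ v1)))))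
≺-bound-enumerated = ∀I (∀I (∃I (bound (v1 · v0) (len · v0)) (∀I (⊃I (∃E (hyp h0)
  (≐-subst (v0 ≺ bound (v4 · v3) (len · v3)) Internal-≺ (≐-sym (∧E₂ (hyp h0)))
    (⊃E (∀E₃ ≺-bound (v3 · v2) (len · v2) v0) (∧E₁ (hyp h0)))))))))

≺-idealization-premise : ∀ {Γ Δ} → Prf Γ Δ (∀st (𝟘 *) (∃' 𝟘 (∀' 𝟘 (mem v0 v2 ⊃ v0 ≺ v1))))
≺-idealization-premise = ∀stI (∀E (∀E ≺-bound-enumerated proj) v0)

nonstandard-𝟘 : ∀ {Γ Δ} → Prf Γ Δ (∃' 𝟘 (¬' (st v0)))
nonstandard-𝟘 = ∃E (⊃E (idealization 𝟘 𝟘 (v0 ≺ v1) Internal-≺) ≺-idealization-premise)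
  (∃I v0 (⊃I (⊃E (∀E ≺-irrefl v0) (∀stE (hyp h1) v0 (hyp h0)))))

embed : ∀ {Γ} σ → Tm Γ 𝟘 → Tm Γ σ
embed 𝟘       n = n
embed (ρ ⇒ τ) n = con cK · embed τ n
embed (ρ *)   n = con cc · embed ρ n · con cε

-- λ a l r. a, so that L b headStep (c(a, l)) = a
headStep : ∀ {Γ} ρ → Tm Γ (ρ ⇒ ρ * ⇒ ρ ⇒ ρ)
headStep ρ = con cΣ · (con cK · con (cK {ρ ⇒ ρ} {ρ *})) · con (cK {ρ} {ρ})

head : ∀ ρ → Tm [] (ρ * ⇒ ρ)
head ρ = con cL · zeroT ρ · headStep ρ

L-headStep-c : ∀ {Γ Δ ρ} (b : Tm Γ ρ) (a : Tm Γ ρ) (l : Tm Γ (ρ *)) →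
               Prf Γ Δ (Eq ρ (con cL · b · headStep ρ · (con cc · a · l)) a)
L-headStep-c b a l =
  Eq-trans (base (axLc _ _ _ _)) (Eq-trans (·-congʳ (·-congʳ (base (axΣ _ _ _)) _) _)
    (Eq-trans (·-congʳ (·-congʳ (·-congʳ (base (axK _ _)) _) _) _)
      (Eq-trans (·-congʳ (base (axK _ _)) _) (base (axK _ _)))))

st-embed : ∀ {Γ Δ} σ (n : Tm Γ 𝟘) → Prf Γ Δ (st (embed σ n)) → Prf Γ Δ (st n)
st-embed 𝟘       n p = p
st-embed (ρ ⇒ τ) n p = st-embed τ n (st-Eq (st-app p (st-closed (zeroT ρ))) (base (axK (embed τ n) _)))
st-embed (ρ *)   n p = st-embed ρ n (st-Eq (st-app (st-closed (head ρ)) p) (L-headStep-c _ _ _))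

nonstandard : ∀ σ → Prf [] [] (NonStd σ)
nonstandard σ = ∃E nonstandard-𝟘 (∃I (embed σ v0) (⊃I (⊃E (hyp h1) (st-embed σ v0 (hyp h0)))))

Below : ∀ {Γ Γ' σ} (χ : Fm (σ ∷ Γ)) (r : Ren Γ Γ') (f : Tm Γ' (𝟘 ⇒ σ)) (m : Tm Γ' 𝟘) → Fm Γ'
Below χ r f m = ∀' 𝟘 (lt v0 (wkT m) ⊃ inst χ (λ x → there (r x)) (wkT f · v0))

subF-Below : ∀ {Γ Γ₁ Γ₂ σ} (χ : Fm (σ ∷ Γ)) (r : Ren Γ Γ₁) (r' : Ren Γ Γ₂) (s : Sub Γ₁ Γ₂) (f : Tm Γ₁ (𝟘 ⇒ σ)) (m : Tm Γ₁ 𝟘) →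
             (∀ {τ} (x : Γ ∋ τ) → s (r x) ≡ var (r' x)) →
             subF s (Below χ r f m) ≡ Below χ r' (subT s f) (subT s m)
subF-Below χ r r' s f m h = cong (∀' 𝟘) (cong₂ _⊃_
  (trans (lt-sub (liftS s) v0 (wkT m)) (cong (lt v0) (liftS-wkT s m)))
  (trans (subF-inst χ _ (λ x → there (r' x)) (liftS s) _ (λ x → cong wkT (h x)))
    (cong (λ g → inst χ (λ x → there (r' x)) (g · v0)) (liftS-wkT s f))))

renF-Below : ∀ {Γ Γ₁ Γ₂ σ} (χ : Fm (σ ∷ Γ)) (r : Ren Γ Γ₁) (q : Ren Γ₁ Γ₂) (f : Tm Γ₁ (𝟘 ⇒ σ)) (m : Tm Γ₁ 𝟘) →
             renF q (Below χ r f m) ≡ Below χ (λ x → q (r x)) (renT q f) (renT q m)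
renF-Below χ r q f m = trans (renF-as-subF q _) (trans (subF-Below χ r _ (ren→sub q) f m (λ x → refl))
  (sym (cong₂ (Below χ _) (renT-as-subT q f) (renT-as-subT q m))))

Below-at : ∀ {Γ Γ' σ Δ} {χ : Fm (σ ∷ Γ)} {r : Ren Γ Γ'} {f m} → Prf Γ' Δ (Below χ r f m) →
           (i : Tm Γ' 𝟘) → Prf Γ' Δ (lt i m) → Prf Γ' Δ (inst χ r (f · i))
Below-at {χ = χ} {r} {f} {m} p i q = ⊃E (subst (Prf _ _) (cong₂ _⊃_ lt-at χ-at) (∀E p i)) q
  where
  lt-at : lt v0 (wkT m) [ i ] ≡ lt i m
  lt-at = trans (lt-sub (sub0 i) v0 (wkT m)) (cong (lt i) (sub0-wkT i m))
  χ-at : inst χ (λ x → there (r x)) (wkT f · v0) [ i ] ≡ inst χ r (f · i)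
  χ-at = trans (subF-inst χ _ r (sub0 i) _ (λ x → refl)) (cong (λ g → inst χ r (g · i)) (sub0-wkT i f))

Below-Z : ∀ {Γ Γ' σ Δ} {χ : Fm (σ ∷ Γ)} {r : Ren Γ Γ'} {f} → Prf Γ' Δ (Below χ r f Z)
Below-Z = ∀I (⊃I (⊥E (⊃E (∀E ≮Z v0) (hyp h0))))

Below-S : ∀ {Γ Γ' σ Δ} (χ : Fm (σ ∷ Γ)) → Internal χ → (r : Ren Γ Γ') (f : Tm Γ' (𝟘 ⇒ σ)) (m : Tm Γ' 𝟘) →
          Prf Γ' Δ (Below χ r f m ⊃ inst χ r (f · m) ⊃ Below χ r f (S' m))
Below-S χ iχ r f m = ⊃I (⊃I (∀I (⊃I (∨E (⊃E (∀E₂ <S⇒<∨≐ (wkT m) v0) (hyp h0))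
  (Below-at (subst (Prf _ _) (renF-Below χ r there f m) (hyp h3)) v0 (hyp h0))
  (leibniz χ iχ (λ x → there (r x)) (·-congˡ (wkT f) (≐-sym (hyp h0)))
    (subst (Prf _ _) (renF-inst χ r there (f · m)) (hyp h2)))))))

Below-memWith : ∀ {Γ Γ' σ Δ} (χ : Fm (σ ∷ Γ)) → Internal χ → (r : Ren Γ Γ') (p : Tm Γ' (σ * ⇒ 𝟘 ⇒ σ)) (L : Tm Γ' (σ *)) (x : Tm Γ' σ) →
                Prf Γ' Δ (Below χ r (p · L) (len · L) ⊃ memWith p x L ⊃ inst χ r x)
Below-memWith χ iχ r p L x = ⊃I (⊃I (∃E (hyp h0)
  (subst (Prf _ _) (sym (renF-inst χ r there x))
    (leibniz χ iχ (λ y → there (r y)) (Eq-sym (∧E₂ (hyp h0)))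
      (Below-at (subst (Prf _ _) (renF-Below χ r there (p · L) (len · L)) (hyp (there (map-∈ wkF h1))))
        v0 (∧E₁ (hyp h0)))))))

∀stE-v0 : ∀ {Γ σ Δ} {χ : Fm (σ ∷ Γ)} → Prf (σ ∷ Γ) Δ (wkF (∀st σ χ)) → Prf (σ ∷ Γ) Δ (st v0) → Prf (σ ∷ Γ) Δ χ
∀stE-v0 {χ = χ} p q = subst (Prf _ _) (subF-liftR-there-[v0] χ) (∀stE p v0 q)

inst-there²-v0 : ∀ {Γ σ τ} (χ : Fm (σ ∷ Γ)) → inst χ (λ x → there (there {τ = τ} x)) v0 ≡ renF (liftR there) χ
inst-there²-v0 χ = sym (trans (renF-as-subF (liftR there) χ) (subF-cong e χ))
  where
  e : ren→sub (liftR there) ≗S (v0 ▸ (λ x → there (there x)))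
  e here      = refl
  e (there x) = refl

module LLPOProof {Γ : Ctx} (σ : Ty) (φ ψ : Fm (σ ∷ Γ)) (iφ : Internal φ) (iψ : Internal ψ) where

  H : Fm Γ
  H = ∀st σ (∀st σ (renF renX φ ∨' renF (liftR there) ψ))

  H-at : ∀ {Γ' Δ} (r : Ren Γ Γ') → Prf Γ' Δ (renF r H) → {a b : Tm Γ' σ} →
         Prf Γ' Δ (st a) → Prf Γ' Δ (st b) → Prf Γ' Δ (inst φ r a ∨' inst ψ r b)
  H-at r p {a} {b} sa sb = subst (Prf _ _) (cong₂ _∨'_ (body-at φ renX a ea) (body-at ψ (liftR there) b eb))
    (∀stE (∀stE p a sa) b sb)
    where
    body-at : (χ : Fm (σ ∷ Γ)) (q : Ren (σ ∷ Γ) (σ ∷ σ ∷ Γ)) (t : Tm _ σ) →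
              (λ {τ} (x : (σ ∷ Γ) ∋ τ) → subT (sub0 b) (liftS (sub0 a) (liftR (liftR r) (q x)))) ≗S (t ▸ r) →
              subF (sub0 b) (subF (liftS (sub0 a)) (renF (liftR (liftR r)) (renF q χ))) ≡ inst χ r t
    body-at χ q t e = trans (cong (λ z → subF (sub0 b) (subF (liftS (sub0 a)) z)) (renF-renF (liftR (liftR r)) q χ))
      (trans (cong (subF (sub0 b)) (subF-renF (liftS (sub0 a)) _ χ)) (trans (subF-subF (sub0 b) _ χ) (subF-cong e χ)))
    ea : (λ {τ} (x : (σ ∷ Γ) ∋ τ) → subT (sub0 b) (liftS (sub0 a) (liftR (liftR r) (renX x)))) ≗S (a ▸ r)
    ea here      = sub0-wkT b a
    ea (there x) = refl
    eb : (λ {τ} (x : (σ ∷ Γ) ∋ τ) → subT (sub0 b) (liftS (sub0 a) (liftR (liftR r) (liftR there x)))) ≗S (b ▸ r)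
    eb here      = refl
    eb (there x) = refl

  ψ∨φ-below : ∀ {Γ'} (r : Ren Γ Γ') (f : Tm Γ' (𝟘 ⇒ σ)) (m : Tm Γ' 𝟘) → Fm Γ'
  ψ∨φ-below r f m = ∀st σ (inst ψ (λ x → there (r x)) v0 ∨' Below φ (λ x → there (r x)) (wkT f) (wkT m))

  subF-ψ∨φ-below : ∀ {Γ₁ Γ₂} (r : Ren Γ Γ₁) (r' : Ren Γ Γ₂) (s : Sub Γ₁ Γ₂) (f : Tm Γ₁ (𝟘 ⇒ σ)) (m : Tm Γ₁ 𝟘) →
                   (∀ {τ} (x : Γ ∋ τ) → s (r x) ≡ var (r' x)) →
                   subF s (ψ∨φ-below r f m) ≡ ψ∨φ-below r' (subT s f) (subT s m)
  subF-ψ∨φ-below r r' s f m h = cong (∀st σ) (cong₂ _∨'_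
    (subF-inst ψ _ (λ x → there (r' x)) (liftS s) v0 (λ x → cong wkT (h x)))
    (trans (subF-Below φ _ (λ x → there (r' x)) (liftS s) (wkT f) (wkT m) (λ x → cong wkT (h x)))
      (cong₂ (Below φ (λ x → there (r' x))) (liftS-wkT s f) (liftS-wkT s m))))

  wkF-ψ∨φ-below : ∀ {Γ' τ} (r : Ren Γ Γ') f m →
                  wkF {τ = τ} (ψ∨φ-below r f m) ≡ ψ∨φ-below (λ x → there (r x)) (wkT f) (wkT m)
  wkF-ψ∨φ-below r f m = trans (renF-as-subF there _) (trans (subF-ψ∨φ-below r _ (ren→sub there) f m (λ x → refl))
    (sym (cong₂ (ψ∨φ-below _) (renT-as-subT there f) (renT-as-subT there m))))

  ψ∨φ-below-[] : ∀ {Γ'} (r : Ren Γ Γ') f (t : Tm Γ' 𝟘) → ψ∨φ-below (λ x → there (r x)) (wkT f) v0 [ t ] ≡ ψ∨φ-below r f t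
  ψ∨φ-below-[] r f t = trans (subF-ψ∨φ-below _ r (sub0 t) (wkT f) v0 (λ x → refl)) (cong (λ g → ψ∨φ-below r g t) (sub0-wkT t f))

  ψ∨φ-below-at : ∀ {Γ' Δ} {r : Ren Γ Γ'} {f m} → Prf Γ' Δ (ψ∨φ-below r f m) → (y : Tm Γ' σ) → Prf Γ' Δ (st y) →
                 Prf Γ' Δ (inst ψ r y ∨' Below φ r f m)
  ψ∨φ-below-at {r = r} {f} {m} p y q = subst (Prf _ _) (cong₂ _∨'_
      (subF-inst ψ _ r (sub0 y) v0 (λ x → refl))
      (trans (subF-Below φ _ r (sub0 y) (wkT f) (wkT m) (λ x → refl)) (cong₂ (Below φ r) (sub0-wkT y f) (sub0-wkT y m))))
    (∀stE p y q)

  -- Given a standard y, apply H to (f m, y): either ψ(y), or φ(f m) and then the hypothesis at y.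
  ψ∨φ-below-S : ∀ {Γ' Δ} (r : Ren Γ Γ') (f : Tm Γ' (𝟘 ⇒ σ)) (m : Tm Γ' 𝟘) →
                Prf Γ' Δ (renF r H ⊃ st f ⊃ st m ⊃ ψ∨φ-below r f m ⊃ ψ∨φ-below r f (S' m))
  ψ∨φ-below-S {Γ'} {Δ} r f m = ⊃I (⊃I (⊃I (⊃I (∀stI
    (∨E (H-at r' Hʷ st-fm (hyp h0))
      (∨E (ψ∨φ-below-at (weaken₁ IH) v0 (hyp h1))
        (∨I₁ (hyp h0))
        (∨I₂ (⊃E₂ (Below-S φ iφ r' (wkT f) (wkT m)) (hyp h0) (hyp h1))))
      (∨I₁ (hyp h0)))))))
    where
    r' : Ren Γ (σ ∷ Γ')
    r' x = there (r x)
    Δ' : List (Fm (σ ∷ Γ'))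
    Δ' = st v0 ∷ map wkF (ψ∨φ-below r f m ∷ st m ∷ st f ∷ renF r H ∷ Δ)
    Hʷ : Prf (σ ∷ Γ') Δ' (renF r' H)
    Hʷ = subst (Prf _ _) (renF-renF there r H) (hyp (there (map-∈ wkF h3)))
    st-fm : Prf (σ ∷ Γ') Δ' (st (wkT f · wkT m))
    st-fm = st-app (hyp (there (map-∈ wkF h2))) (hyp (there (map-∈ wkF h1)))
    IH : Prf (σ ∷ Γ') Δ' (ψ∨φ-below r' (wkT f) (wkT m))
    IH = subst (Prf _ _) (wkF-ψ∨φ-below r f m) (hyp (there (map-∈ wkF h0)))

  ψ∨φ-below-all : ∀ {Γ' Δ} (r : Ren Γ Γ') (f : Tm Γ' (𝟘 ⇒ σ)) →
                  Prf Γ' Δ (renF r H ⊃ st f ⊃ ∀st 𝟘 (ψ∨φ-below (λ x → there (r x)) (wkT f) v0))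
  ψ∨φ-below-all {Δ = Δ} r f = ⊃I (⊃I (⊃E₂ (base (indExt C))
    (subst (Prf _ _) (sym (ψ∨φ-below-[] r f Z)) (∀stI (∨I₂ Below-Z)))
    (∀stI (subst (Prf _ _) (cong (C ⊃_) (sym C[S]))
      (⊃E (⊃E (⊃E (ψ∨φ-below-S _ (wkT f) v0) Hʷ) (hyp (there (map-∈ wkF h0)))) (hyp h0))))))
    where
    C : Fm (𝟘 ∷ _)
    C = ψ∨φ-below (λ x → there (r x)) (wkT f) v0
    C[S] : subF subSuc C ≡ ψ∨φ-below (λ x → there (r x)) (wkT f) (S' v0)
    C[S] = trans (subF-ψ∨φ-below _ _ subSuc (wkT f) v0 (λ x → refl)) (cong (λ g → ψ∨φ-below _ g (S' v0)) (subSuc-wkT f))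
    Hʷ : Prf (𝟘 ∷ _) (st v0 ∷ map wkF (st f ∷ renF r H ∷ Δ)) (renF (λ x → there (r x)) H)
    Hʷ = subst (Prf _ _) (renF-renF there r H) (hyp (there (map-∈ wkF h1)))

  φ∨ψ-below : ∀ {Γ'} (r : Ren Γ Γ') (f : Tm Γ' (𝟘 ⇒ σ)) (n m : Tm Γ' 𝟘) → Fm Γ'
  φ∨ψ-below r f n m = Below φ r f n ∨' Below ψ r f m

  φ∨ψ-below-[] : ∀ {Γ'} (r : Ren Γ Γ') f n (t : Tm Γ' 𝟘) →
                 φ∨ψ-below (λ x → there (r x)) (wkT f) (wkT n) v0 [ t ] ≡ φ∨ψ-below r f n t
  φ∨ψ-below-[] r f n t = cong₂ _∨'_
    (trans (subF-Below φ _ r (sub0 t) (wkT f) (wkT n) (λ x → refl)) (cong₂ (Below φ r) (sub0-wkT t f) (sub0-wkT t n)))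
    (trans (subF-Below ψ _ r (sub0 t) (wkT f) v0 (λ x → refl)) (cong (λ g → Below ψ r g t) (sub0-wkT t f)))

  φ∨ψ-below-S : ∀ {Γ' Δ} (r : Ren Γ Γ') (f : Tm Γ' (𝟘 ⇒ σ)) (n m : Tm Γ' 𝟘) →
                Prf Γ' Δ (st f ⊃ st m ⊃ ψ∨φ-below r f n ⊃ φ∨ψ-below r f n m ⊃ φ∨ψ-below r f n (S' m))
  φ∨ψ-below-S r f n m = ⊃I (⊃I (⊃I (⊃I (∨E (hyp h0) (∨I₁ (hyp h0))
    (∨E (ψ∨φ-below-at (hyp h2) (f · m) (st-app (hyp (there h3)) (hyp h3)))
      (∨I₂ (⊃E₂ (Below-S ψ iψ r f m) (hyp h1) (hyp h0)))
      (∨I₁ (hyp h0)))))))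

  φ∨ψ-below-all : ∀ {Γ' Δ} (r : Ren Γ Γ') (f : Tm Γ' (𝟘 ⇒ σ)) (n : Tm Γ' 𝟘) →
                  Prf Γ' Δ (st f ⊃ ψ∨φ-below r f n ⊃ ∀st 𝟘 (φ∨ψ-below (λ x → there (r x)) (wkT f) (wkT n) v0))
  φ∨ψ-below-all r f n = ⊃I (⊃I (⊃E₂ (base (indExt D))
    (subst (Prf _ _) (sym (φ∨ψ-below-[] r f n Z)) (∨I₂ Below-Z))
    (∀stI (subst (Prf _ _) (cong (D ⊃_) (sym D[S]))
      (⊃E (⊃E (⊃E (φ∨ψ-below-S _ (wkT f) (wkT n) v0) (hyp (there (map-∈ wkF h1)))) (hyp h0))
        (subst (Prf _ _) (wkF-ψ∨φ-below r f n) (hyp (there (map-∈ wkF h0)))))))))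
    where
    D : Fm (𝟘 ∷ _)
    D = φ∨ψ-below (λ x → there (r x)) (wkT f) (wkT n) v0
    D[S] : subF subSuc D ≡ φ∨ψ-below (λ x → there (r x)) (wkT f) (wkT n) (S' v0)
    D[S] = cong₂ _∨'_
      (trans (subF-Below φ _ _ subSuc (wkT f) (wkT n) (λ x → refl)) (cong₂ (Below φ _) (subSuc-wkT f) (subSuc-wkT n)))
      (trans (subF-Below ψ _ _ subSuc (wkT f) v0 (λ x → refl)) (cong (λ g → Below ψ _ g (S' v0)) (subSuc-wkT f)))

  finite-LLPO : ∀ {Γ' Δ} (r : Ren Γ Γ') (f : Tm Γ' (𝟘 ⇒ σ)) (n : Tm Γ' 𝟘) →
                Prf Γ' Δ (renF r H ⊃ st f ⊃ st n ⊃ Below φ r f n ∨' Below ψ r f n)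
  finite-LLPO {Δ = Δ} r f n = ⊃I (⊃I (⊃I (subst (Prf _ _) (φ∨ψ-below-[] r f n n)
    (∀stE (⊃E₂ (φ∨ψ-below-all r f n) (hyp h1) ψ∨φ-below-n) n (hyp h0)))))
    where
    ψ∨φ-below-n : Prf _ (st n ∷ st f ∷ renF r H ∷ Δ) (ψ∨φ-below r f n)
    ψ∨φ-below-n = subst (Prf _ _) (ψ∨φ-below-[] r f n) (∀stE (⊃E₂ (ψ∨φ-below-all r f) (hyp h2) (hyp h1)) n (hyp h0))

  Θ : ∀ {Γ'} → Ren Γ Γ' → Fm (σ ∷ 𝟘 ∷ Γ')
  Θ r = (v1 ≐ Z ⊃ inst φ r'' v0) ∧' (v1 ≐ Z ∨' inst ψ r'' v0)
    where
    r'' : Ren Γ (σ ∷ 𝟘 ∷ _)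
    r'' x = there (there (r x))

  Internal-Θ : Internal (Θ (λ x → x))
  Internal-Θ = i∧ (i⊃ i≐ (Internal-subF _ iφ)) (i∨ i≐ (Internal-subF _ iψ))

  subF-Θ : ∀ {Γ₁ Γ₂} (s : Sub Γ₁ Γ₂) (r : Ren Γ Γ₁) (r' : Ren Γ Γ₂) →
           (∀ {τ} (x : Γ ∋ τ) → s (r x) ≡ var (r' x)) → subF (liftS (liftS s)) (Θ r) ≡ Θ r'
  subF-Θ s r r' h = cong₂ (λ a b → (v1 ≐ Z ⊃ a) ∧' (v1 ≐ Z ∨' b))
    (subF-inst φ _ _ (liftS (liftS s)) v0 (λ x → cong wkT (cong wkT (h x))))
    (subF-inst ψ _ _ (liftS (liftS s)) v0 (λ x → cong wkT (cong wkT (h x))))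

  renF-Θ : ∀ {Γ₁ Γ₂} (q : Ren Γ₁ Γ₂) (r : Ren Γ Γ₁) → renF (liftR (liftR q)) (Θ r) ≡ Θ (λ x → q (r x))
  renF-Θ q r = cong₂ (λ a b → (v1 ≐ Z ⊃ a) ∧' (v1 ≐ Z ∨' b))
    (renF-inst φ _ (liftR (liftR q)) v0) (renF-inst ψ _ (liftR (liftR q)) v0)

  Θ-decides : ∀ {Δ} → Prf (𝟘 ∷ Γ) (∀st σ (Θ (λ x → x)) ∷ Δ) (wkF (∀st σ φ ∨' ∀st σ ψ))
  Θ-decides = ∨E (∀E Z-or-≢Z v0)
    (∨I₁ (∀stI (subst (Prf _ _) (inst-there²-v0 φ) (⊃E (∧E₁ Θ-at-v0) (hyp (there (map-∈ wkF h0)))))))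
    (∨I₂ (∀stI (∨E (∧E₂ Θ-at-v0)
      (⊥E (⊃E (hyp (there (there (map-∈ wkF h0)))) (hyp h0)))
      (subst (Prf _ _) (inst-there²-v0 ψ) (hyp h0)))))
    where
    Θ-at-v0 : ∀ {Δ χ} → Prf (σ ∷ 𝟘 ∷ Γ) (st v0 ∷ map wkF (χ ∷ ∀st σ (Θ (λ x → x)) ∷ Δ)) (Θ (λ x → x))
    Θ-at-v0 = ∀stE-v0 (hyp (there (map-∈ wkF h1))) (hyp h0)

  Enum : Ty
  Enum = σ * ⇒ 𝟘 ⇒ σ

  -- the premise of I for Θ, with membership in L read through an enumeration p (variable 0)
  Θ-premise : Fm (Enum ∷ Γ)
  Θ-premise = ∀st (σ *) (∃' 𝟘 (∀' σ (memWith v3 v0 v2 ⊃ Θ (λ x → there (there x)))))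

  -- By finite LLPO on the standard sequence L, y = 0 works if φ holds on L and y = 1 if ψ does.
  Θ-premise-holds : Prf Γ (H ∷ []) (∀' Enum (st v0 ⊃ Θ-premise))
  Θ-premise-holds = ∀I (⊃I (∀stI (∨E
    (⊃E (⊃E (⊃E (finite-LLPO r₂ (v1 · v0) (len · v0)) Hʷ) (st-app (hyp h1) (hyp h0))) (st-app (st-closed len) (hyp h0)))
    (∃I Z (∀I (⊃I (∧I (⊃I (weaken₁ (member-satisfies φ iφ Z))) (∨I₁ (base (eqRefl Z)))))))
    (∃I (S' Z) (∀I (⊃I (∧I (⊃I (⊥E (S≢Z (hyp h0)))) (∨I₂ (member-satisfies ψ iψ (S' Z))))))))))
    where
    r₂ : Ren Γ (σ * ∷ Enum ∷ Γ)
    r₂ x = there (there x)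
    r₃ : Ren Γ (σ ∷ σ * ∷ Enum ∷ Γ)
    r₃ x = there (r₂ x)
    Hʷ : Prf (σ * ∷ Enum ∷ Γ) (st v0 ∷ map wkF (st v0 ∷ map wkF (H ∷ []))) (renF r₂ H)
    Hʷ = subst (Prf _ _) (renF-renF there there H) (hyp h2)
    member-satisfies : ∀ {Δ} (χ : Fm (σ ∷ Γ)) → Internal χ → (t : Tm (σ * ∷ Enum ∷ Γ) 𝟘) →
      Prf (σ ∷ σ * ∷ Enum ∷ Γ) (subF (liftS (sub0 t)) (memWith v3 v0 v2) ∷ map wkF (Below χ r₂ (v1 · v0) (len · v0) ∷ Δ))
        (subF (liftS (sub0 t)) (inst χ (λ x → there (there (r₂ x))) v0))
    member-satisfies χ iχ t = subst (Prf _ _) (sym (subF-inst χ _ r₃ (liftS (sub0 t)) v0 (λ x → refl)))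
      (⊃E₂ (Below-memWith χ iχ r₃ v2 v1 v0)
        (subst (Prf _ _) (renF-Below χ r₂ there (v1 · v0) (len · v0)) (hyp (there (map-∈ wkF h0))))
        (subst (Prf _ _) (subF-memWith (liftS (sub0 t)) v3 v0 v2) (hyp h0)))

  Θ-premise-at : (p : Tm Γ Enum) → wkT (wkT (wkT (wkT p))) ≡ proj →
                 subF (sub0 p) Θ-premise ≡ ∀st (σ *) (∃' 𝟘 (∀' σ (mem v0 v2 ⊃ renF (liftR (liftR there)) (Θ (λ x → x)))))
  Θ-premise-at p e = cong (λ z → ∀st (σ *) (∃' 𝟘 (∀' σ z))) (cong₂ _⊃_
    (trans (subF-memWith (liftS (liftS (liftS (sub0 p)))) v3 v0 v2)
      (cong (λ q → ∃' 𝟘 (lt v0 (len · wkT v2) ∧' Eq σ (wkT v0) (q · wkT v2 · v0))) e))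
    (trans (subF-Θ (liftS (sub0 p)) _ there (λ x → refl)) (sym (renF-Θ there (λ x → x)))))

  llpo : Prf Γ [] (LLPO σ φ ψ)
  llpo = ⊃I (∃E (⊃E (idealization σ 𝟘 (Θ (λ x → x)) Internal-Θ) premise) Θ-decides)
    where
    wkT⁴ : ∀ {Γ' τ α β γ δ} (t : Tm Γ' τ) →
           wkT {τ = δ} (wkT {τ = γ} (wkT {τ = β} (wkT {τ = α} t))) ≡ renT (λ x → there (there (there (there x)))) t
    wkT⁴ t = trans (cong wkT (trans (cong wkT (renT-renT there there t)) (renT-renT there _ t))) (renT-renT there _ t)
    st-proj : Prf Γ (H ∷ []) (st proj)
    st-proj = subst (λ z → Prf Γ (H ∷ []) (st z)) (proj-ren (λ ())) (st-closed proj)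
    premise : Prf Γ (H ∷ []) (∀st (σ *) (∃' 𝟘 (∀' σ (mem v0 v2 ⊃ renF (liftR (liftR there)) (Θ (λ x → x))))))
    premise = subst (Prf _ _) (Θ-premise-at proj (trans (wkT⁴ proj) (proj-ren _)))
      (⊃E (∀E Θ-premise-holds proj) st-proj)

mainTheorem13 : ((σ : Ty) → Pf EHAstI [] [] (NonStd σ))
    × (∀ {Γ} (σ : Ty) (φ ψ : Fm (σ ∷ Γ)) → Internal φ → Internal ψ
    → Pf EHAstI Γ [] (LLPO σ φ ψ))
mainTheorem13 = nonstandard , λ σ φ ψ iφ iψ → LLPOProof.llpo σ φ ψ iφ iψ
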